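{- Given an inhibitorless reaction system $\mathcal{A}=(S,A)\in\mathcal{RS}(\infty,0)$, it can be decided in polynomial time whether $\mathrm{res}_{\mathcal{A}}:2^S\to 2^S$ is bijective.
   Context: A reaction over a finite set $S$ is a triple $a=(R_a,I_a,P_a)$ of subsets of $S$ (reactants, inhibitors, products) with $P_a\neq\varnothing$. A reaction system is a pair $\mathcal{A}=(S,A)$ with $S$ a finite background set and $A$ a set of reactions over $S$. A reaction $a$ is enabled in a state $T\subseteq S$ if $R_a\subseteq T$ and $I_a\cap T=\varnothing$. The result function is $\mathrm{res}_{\mathcal{A}}(T)=\bigcup\{P_a : a\in A \text{ enabled in } T\}$. $\mathcal{RS}(\infty,0)$ (inhibitorless systems) is the class of reaction systems in which every reaction has $I_a=\varnothing$. The input is given by explicitly listing $S$ and the reactions. -}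

module Defs where

open import Data.Nat using (ℕ; zero; suc; _+_; _*_; _^_)
open import Data.Bool using (Bool; true; false; if_then_else_)
import Data.Bool.Properties as BoolP
open import Data.Fin using (Fin)
import Data.Fin as F
open import Data.Fin.Subset using (Subset; _⊆_; _∩_; _∪_; ⊥; Nonempty)
open import Data.Fin.Subset.Properties using (_⊆?_)
open import Data.Vec using (Vec; toList)
import Data.Vec.Properties as VecP
open import Data.List using (List; []; _∷_; _++_; replicate; concatMap; length)
open import Data.Product using (_×_; _,_)
open import Data.Sum using (_⊎_; inj₁; inj₂)
open import Data.Maybe using (Maybe; just; nothing)
open import Relation.Nullary using (Dec; yes; no; _×-dec_)
open import Relation.Nullary.Decidable using (⌊_⌋)
open import Relation.Binary.PropositionalEquality using (_≡_)

record Reaction (n : ℕ) : Set where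
  field
    reactants  : Subset n
    inhibitors : Subset n
    products   : Subset n
    products-nonempty : Nonempty products
open Reaction public

record RS : Set where
  field
    size      : ℕ
    reactions : List (Reaction size)
open RS public

Enabled : ∀ {n} → Reaction n → Subset n → Set
Enabled a T = (reactants a ⊆ T) × (inhibitors a ∩ T ≡ ⊥)

enabled? : ∀ {n} (a : Reaction n) (T : Subset n) → Dec (Enabled a T)
enabled? a T = (reactants a ⊆? T) ×-dec VecP.≡-dec BoolP._≟_ (inhibitors a ∩ T) ⊥

resL : ∀ {n} → List (Reaction n) → Subset n → Subset n
resL []       T = ⊥
resL (a ∷ as) T = if ⌊ enabled? a T ⌋ then products a ∪ resL as T else resL as T

res : (𝒜 : RS) → Subset (size 𝒜) → Subset (size 𝒜)
res 𝒜 = resL (reactions 𝒜)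

data AllL {A : Set} (P : A → Set) : List A → Set where
  []  : AllL P []
  _∷_ : ∀ {x xs} → P x → AllL P xs → AllL P (x ∷ xs)

Inhibitorless : RS → Set
Inhibitorless 𝒜 = AllL (λ a → inhibitors a ≡ ⊥) (reactions 𝒜)

-- Encoding of a reaction system as a word over the alphabet {0,1,#}
-- (Fin 3: zero = '0', suc zero = '1', suc (suc zero) = '#').

sym0 sym1 symSep : Fin 3
sym0 = F.zero
sym1 = F.suc F.zero
symSep = F.suc (F.suc F.zero)

encBit : Bool → Fin 3
encBit true  = sym1
encBit false = sym0

encSubset : ∀ {n} → Subset n → List (Fin 3)
encSubset s = Data.List.map encBit (toList s)

encReaction : ∀ {n} → Reaction n → List (Fin 3)
encReaction a = encSubset (reactants a) ++ encSubset (inhibitors a)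
                ++ encSubset (products a) ++ (symSep ∷ [])

encode : RS → List (Fin 3)
encode 𝒜 = replicate (size 𝒜) sym1 ++ (symSep ∷ concatMap encReaction (reactions 𝒜))

data Move : Set where
  left right stay : Move

record TM : Set where
  field
    nStates  : ℕ
    nSymbols : ℕ
    start    : Fin nStates
    blank    : Fin nSymbols
    input    : Fin 3 → Fin nSymbols
    -- transition: either continue (new state, written symbol, move)
    -- or halt with a Boolean answer (accept = true / reject = false)
    δ        : Fin nStates → Fin nSymbols →
               (Fin nStates × Fin nSymbols × Move) ⊎ Bool

module _ (M : TM) where
  open TM M

  -- configuration: state, reversed left part, scanned symbol, right part
  record Config : Set where
    constructor cfg
    field
      state : Fin nStates
      lft   : List (Fin nSymbols)
      cur   : Fin nSymbols
      rgt   : List (Fin nSymbols)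

  moveHead : Move → List (Fin nSymbols) → Fin nSymbols → List (Fin nSymbols)
           → List (Fin nSymbols) × Fin nSymbols × List (Fin nSymbols)
  moveHead stay  l c r        = l , c , r
  moveHead left  []      c r  = [] , blank , c ∷ r
  moveHead left  (x ∷ l) c r  = l , x , c ∷ r
  moveHead right l c []       = c ∷ l , blank , []
  moveHead right l c (x ∷ r)  = c ∷ l , x , r

  initConfig : List (Fin 3) → Config
  initConfig []      = cfg start [] blank []
  initConfig (x ∷ w) = cfg start [] (input x) (Data.List.map input w)

  run : ℕ → Config → Maybe Bool
  run zero    c = nothing
  run (suc t) (cfg q l a r) with δ q a
  ... | inj₂ b = just b
  ... | inj₁ (q′ , a′ , m) with moveHead m l a′ r
  ...   | (l′ , c′ , r′) = run t (cfg q′ l′ c′ r′)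

DecidesInPolyTime : TM → (RS → Set) → Set
DecidesInPolyTime M Q =
  Data.Product.∃ λ c → Data.Product.∃ λ d → (𝒜 : RS) → Inhibitorless 𝒜 →
    Data.Product.∃ λ b →
      (run M (c * suc (length (encode 𝒜)) ^ d) (initConfig M (encode 𝒜)) ≡ just b)
      × ((b ≡ true → Q 𝒜) × (Q 𝒜 → b ≡ true))

module Submission where

-- For inhibitorless 𝒜 the map res is monotone, and a monotone bijection of 2^S preserves
-- cardinalities; hence it sends {x} to {π x} for a permutation π and satisfies res T = π[T].
-- Read off the reactions, res is bijective iff every reaction has nonempty reactants, every s is
-- the reactant set of some reaction, every t is produced from {s} for exactly one s = σ t, and
-- every reaction producing t has σ t among its reactants. A Turing machine checks this with
-- O(n²) sweeps over the input, keeping s and t as marks that move one cell per sweep and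
-- evaluating each condition reaction by reaction in finitely many registers; as each sweep
-- costs O(|w|) steps, it halts within 16 (|w| + 1)³ steps.

module SubsetProperties where

  open import Data.Nat using (zero; suc; _≤_; _<_; s≤s; _≤?_)
  open import Data.Nat.Properties using (≤-trans; <-irrefl; ≰⇒>; suc-injective; ≤-pred)
  open import Data.Fin using (Fin; zero; suc)
  open import Data.Fin.Subset using (Subset; _∈_; _∉_; _⊆_; ⊥; ⁅_⁆; ∣_∣; inside; outside)
  open import Data.Fin.Subset.Properties using (p⊆q⇒∣p∣≤∣q∣; ⊆-antisym; drop-∷-⊆)
  open import Data.Vec using ([]; _∷_; _[_]≔_; here; there)
  open import Data.Product using (∃; _,_)
  open import Data.Sum using (_⊎_; inj₁; inj₂)
  open import Data.Empty using (⊥-elim)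
  open import Relation.Nullary using (¬_; yes; no)
  open import Relation.Binary.PropositionalEquality

  ⊆∧∣∣≤⇒⊇ : ∀ {n} (p q : Subset n) → p ⊆ q → ∣ q ∣ ≤ ∣ p ∣ → q ⊆ p
  ⊆∧∣∣≤⇒⊇ [] [] p⊆q _ ()
  ⊆∧∣∣≤⇒⊇ (inside ∷ p) (inside ∷ q) p⊆q ∣q∣≤∣p∣ here = here
  ⊆∧∣∣≤⇒⊇ (inside ∷ p) (inside ∷ q) p⊆q ∣q∣≤∣p∣ (there x) = there (⊆∧∣∣≤⇒⊇ p q (drop-∷-⊆ p⊆q) (≤-pred ∣q∣≤∣p∣) x)
  ⊆∧∣∣≤⇒⊇ (outside ∷ p) (outside ∷ q) p⊆q ∣q∣≤∣p∣ (there x) = there (⊆∧∣∣≤⇒⊇ p q (drop-∷-⊆ p⊆q) ∣q∣≤∣p∣ x)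
  ⊆∧∣∣≤⇒⊇ (outside ∷ p) (inside ∷ q) p⊆q ∣q∣≤∣p∣ x = ⊥-elim (<-irrefl refl (≤-trans ∣q∣≤∣p∣ (p⊆q⇒∣p∣≤∣q∣ (drop-∷-⊆ p⊆q))))
  ⊆∧∣∣≤⇒⊇ (inside ∷ p) (outside ∷ q) p⊆q _ x with p⊆q here
  ... | ()

  ⊆∧≢⇒∣∣< : ∀ {n} {p q : Subset n} → p ⊆ q → ¬ (p ≡ q) → ∣ p ∣ < ∣ q ∣
  ⊆∧≢⇒∣∣< {p = p} {q} p⊆q p≢q with ∣ q ∣ ≤? ∣ p ∣
  ... | yes q≤p = ⊥-elim (p≢q (⊆-antisym p⊆q (⊆∧∣∣≤⇒⊇ p q p⊆q q≤p)))
  ... | no q≰p = ≰⇒> q≰p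

  add : ∀ {n} → Fin n → Subset n → Subset n
  add x p = p [ x ]≔ inside

  del : ∀ {n} → Fin n → Subset n → Subset n
  del x p = p [ x ]≔ outside

  ∣add∣ : ∀ {n} (x : Fin n) p → x ∉ p → ∣ add x p ∣ ≡ suc ∣ p ∣
  ∣add∣ zero (inside ∷ p) x∉p = ⊥-elim (x∉p here)
  ∣add∣ zero (outside ∷ p) x∉p = refl
  ∣add∣ (suc x) (inside ∷ p) x∉p = cong suc (∣add∣ x p (λ m → x∉p (there m)))
  ∣add∣ (suc x) (outside ∷ p) x∉p = ∣add∣ x p (λ m → x∉p (there m))

  ∣del∣ : ∀ {n} (x : Fin n) p → x ∈ p → suc ∣ del x p ∣ ≡ ∣ p ∣
  ∣del∣ zero (inside ∷ p) x∈p = refl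
  ∣del∣ (suc x) (inside ∷ p) (there x∈p) = cong suc (∣del∣ x p x∈p)
  ∣del∣ (suc x) (outside ∷ p) (there x∈p) = ∣del∣ x p x∈p

  x∈add : ∀ {n} (x : Fin n) p → x ∈ add x p
  x∈add zero (_ ∷ p) = here
  x∈add (suc x) (_ ∷ p) = there (x∈add x p)

  x∉del : ∀ {n} (x : Fin n) p → x ∉ del x p
  x∉del zero (_ ∷ p) ()
  x∉del (suc x) (_ ∷ p) (there m) = x∉del x p m

  ⊆add : ∀ {n} (x : Fin n) p → p ⊆ add x p
  ⊆add zero (_ ∷ p) here = here
  ⊆add zero (_ ∷ p) (there m) = there m
  ⊆add (suc x) (_ ∷ p) here = here
  ⊆add (suc x) (_ ∷ p) (there m) = there (⊆add x p m)

  del⊆ : ∀ {n} (x : Fin n) p → del x p ⊆ p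
  del⊆ zero (_ ∷ p) (there m) = there m
  del⊆ (suc x) (_ ∷ p) here = here
  del⊆ (suc x) (_ ∷ p) (there m) = there (del⊆ x p m)

  ∈add⁻ : ∀ {n} (x : Fin n) p {y} → y ∈ add x p → y ≡ x ⊎ y ∈ p
  ∈add⁻ zero (_ ∷ p) here = inj₁ refl
  ∈add⁻ zero (_ ∷ p) (there m) = inj₂ (there m)
  ∈add⁻ (suc x) (_ ∷ p) here = inj₂ here
  ∈add⁻ (suc x) (_ ∷ p) (there m) with ∈add⁻ x p m
  ... | inj₁ e = inj₁ (cong suc e)
  ... | inj₂ m′ = inj₂ (there m′)

  ∣∣<n⇒∃∉ : ∀ {n} (p : Subset n) → ∣ p ∣ < n → ∃ λ x → x ∉ p
  ∣∣<n⇒∃∉ (outside ∷ p) _ = zero , λ ()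
  ∣∣<n⇒∃∉ (inside ∷ p) (s≤s ∣p∣<n) with ∣∣<n⇒∃∉ p ∣p∣<n
  ... | x , x∉p = suc x , λ { (there m) → x∉p m }

  ∣∣>0⇒∃∈ : ∀ {n} (p : Subset n) → 0 < ∣ p ∣ → ∃ λ x → x ∈ p
  ∣∣>0⇒∃∈ (inside ∷ p) _ = zero , here
  ∣∣>0⇒∃∈ (outside ∷ p) 0<∣p∣ with ∣∣>0⇒∃∈ p 0<∣p∣
  ... | x , x∈p = suc x , there x∈p

  ∣∣≡0⇒≡⊥ : ∀ {n} (p : Subset n) → ∣ p ∣ ≡ 0 → p ≡ ⊥
  ∣∣≡0⇒≡⊥ [] _ = refl
  ∣∣≡0⇒≡⊥ (outside ∷ p) e = cong (outside ∷_) (∣∣≡0⇒≡⊥ p e)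

  ∣∣≡1⇒singleton : ∀ {n} (p : Subset n) → ∣ p ∣ ≡ 1 → ∃ λ y → p ≡ ⁅ y ⁆
  ∣∣≡1⇒singleton (inside ∷ p) e = zero , cong (inside ∷_) (∣∣≡0⇒≡⊥ p (suc-injective e))
  ∣∣≡1⇒singleton (outside ∷ p) e with ∣∣≡1⇒singleton p e
  ... | y , p≡⁅y⁆ = suc y , cong (outside ∷_) p≡⁅y⁆


module MonotoneSubsetMaps where

  open import Data.Nat using (ℕ; zero; suc; _≤_; _<_; s≤s; z≤n; _+_; _∸_)
  open import Data.Nat.Properties using (≤-reflexive; ≤-trans; ≤-pred; ≤-antisym; suc-injective; +-suc; +-identityʳ; m+[n∸m]≡n; m<m+n)
  open import Data.Fin using (Fin)
  open import Data.Fin.Subset using (Subset; _∈_; _∉_; _⊆_; ⊥; ⊤; ⁅_⁆; ∣_∣)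
  open import Data.Fin.Subset.Properties using (∉⊥; ∈⊤; ⊆-antisym; ∣p∣≤n; ∣⊤∣≡n; ∣p∣≡n⇒p≡⊤; ∣⁅x⁆∣≡1; x∈⁅x⁆; x∈⁅y⁆⇒x≡y)
  open import Data.Product using (∃; _×_; _,_; proj₁; proj₂)
  open import Data.Sum using (inj₁; inj₂)
  open import Data.Empty using (⊥-elim)
  open import Relation.Nullary using (¬_)
  open import Relation.Binary.PropositionalEquality
  open import Function.Definitions using (Bijective)
  open SubsetProperties

  module Bijection {n : ℕ} (f : Subset n → Subset n) (mono : ∀ {T U} → T ⊆ U → f T ⊆ f U)
           (bij : Bijective _≡_ _≡_ f) where

    private
      f-injective = proj₁ bij
      f-surjective = proj₂ bij

    f⊥≡⊥ : f ⊥ ≡ ⊥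
    f⊥≡⊥ = ⊆-antisym (λ m → subst (_ ∈_) (proj₂ (f-surjective ⊥) refl) (mono (λ y → ⊥-elim (∉⊥ y)) m))
                     (λ y → ⊥-elim (∉⊥ y))

    private
      strict-mono : ∀ {T U} → T ⊆ U → ¬ (T ≡ U) → ∣ f T ∣ < ∣ f U ∣
      strict-mono T⊆U T≢U = ⊆∧≢⇒∣∣< (mono T⊆U) (λ e → T≢U (f-injective e))

      card-lower : ∀ k T → ∣ T ∣ ≡ k → k ≤ ∣ f T ∣
      card-lower zero T e = z≤n
      card-lower (suc k) T e with ∣∣>0⇒∃∈ T (subst (0 <_) (sym e) (s≤s z≤n))
      ... | x , x∈T = ≤-trans (s≤s (card-lower k (del x T) (suc-injective (trans (∣del∣ x T x∈T) e))))
                              (strict-mono (del⊆ x T) (λ eq → x∉del x T (subst (x ∈_) (sym eq) x∈T)))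

      card-upper : ∀ k T → ∣ T ∣ + k ≡ n → ∣ f T ∣ ≤ ∣ T ∣
      card-upper zero T e = subst (∣ f T ∣ ≤_) (sym (trans (sym (+-identityʳ ∣ T ∣)) e)) (∣p∣≤n (f T))
      card-upper (suc k) T e with ∣∣<n⇒∃∉ T (subst (∣ T ∣ <_) e (m<m+n ∣ T ∣ (s≤s z≤n)))
      ... | x , x∉T = ≤-pred (≤-trans (strict-mono (⊆add x T) (λ eq → x∉T (subst (x ∈_) (sym eq) (x∈add x T))))
                                      (subst (∣ f (add x T) ∣ ≤_) (∣add∣ x T x∉T)
                                             (card-upper k (add x T) (trans (cong (_+ k) (∣add∣ x T x∉T)) (trans (sym (+-suc ∣ T ∣ k)) e)))))

    ∣f∣≡∣∣ : ∀ T → ∣ f T ∣ ≡ ∣ T ∣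
    ∣f∣≡∣∣ T = ≤-antisym (card-upper (n ∸ ∣ T ∣) T (m+[n∸m]≡n (∣p∣≤n T))) (card-lower ∣ T ∣ T refl)

    private
      f⁅⁆-singleton : ∀ x → ∃ λ y → f ⁅ x ⁆ ≡ ⁅ y ⁆
      f⁅⁆-singleton x = ∣∣≡1⇒singleton (f ⁅ x ⁆) (trans (∣f∣≡∣∣ ⁅ x ⁆) (∣⁅x⁆∣≡1 x))

    π : Fin n → Fin n
    π x = proj₁ (f⁅⁆-singleton x)

    f⁅x⁆≡⁅πx⁆ : ∀ x → f ⁅ x ⁆ ≡ ⁅ π x ⁆
    f⁅x⁆≡⁅πx⁆ x = proj₂ (f⁅⁆-singleton x)

    π-injective : ∀ {x y} → π x ≡ π y → x ≡ y
    π-injective {x} {y} e =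
      x∈⁅y⁆⇒x≡y y (subst (x ∈_) (f-injective (trans (f⁅x⁆≡⁅πx⁆ x) (trans (cong ⁅_⁆ e) (sym (f⁅x⁆≡⁅πx⁆ y))))) (x∈⁅x⁆ x))

    π∈f : ∀ {x T} → x ∈ T → π x ∈ f T
    π∈f {x} x∈T = mono (λ y∈⁅x⁆ → subst (_∈ _) (sym (x∈⁅y⁆⇒x≡y _ y∈⁅x⁆)) x∈T) (subst (π x ∈_) (sym (f⁅x⁆≡⁅πx⁆ x)) (x∈⁅x⁆ (π x)))

    InImage : Subset n → Fin n → Set
    InImage T t = ∃ λ s → s ∈ T × π s ≡ t

    private
      -- f T and π[T - x] ∪ {π x} have the same cardinality and the second lies inside the first.
      ∈f-step : ∀ k T x → x ∈ T → ∣ T ∣ ≡ suc k →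
                (∀ {t} → t ∈ f (del x T) → InImage (del x T) t) → ∀ {t} → t ∈ f T → InImage T t
      ∈f-step k T x x∈T e ih {t} t∈fT with ∈add⁻ (π x) (f (del x T)) (⊆∧∣∣≤⇒⊇ U (f T) U⊆fT (≤-reflexive ∣fT∣≡∣U∣) t∈fT)
        where
        T′ = del x T
        U = add (π x) (f T′)
        πx∉fT′ : π x ∉ f T′
        πx∉fT′ m with ih m
        ... | s , s∈T′ , πs≡πx = x∉del x T (subst (_∈ T′) (π-injective πs≡πx) s∈T′)
        U⊆fT : U ⊆ f T
        U⊆fT {y} y∈U with ∈add⁻ (π x) (f T′) y∈U
        ... | inj₁ refl = π∈f x∈T
        ... | inj₂ y∈fT′ = mono (del⊆ x T) y∈fT′
        ∣fT∣≡∣U∣ : ∣ f T ∣ ≡ ∣ U ∣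
        ∣fT∣≡∣U∣ = trans (∣f∣≡∣∣ T) (trans e (sym (trans (∣add∣ (π x) (f T′) πx∉fT′)
                                                      (cong suc (trans (∣f∣≡∣∣ T′) (suc-injective (trans (∣del∣ x T x∈T) e)))))))
      ... | inj₁ t≡πx = x , x∈T , sym t≡πx
      ... | inj₂ t∈fT′ with ih t∈fT′
      ...   | s , s∈T′ , πs≡t = s , del⊆ x T s∈T′ , πs≡t

      ∈f-sized : ∀ k T → ∣ T ∣ ≡ k → ∀ {t} → t ∈ f T → InImage T t
      ∈f-sized zero T e t∈fT = ⊥-elim (∉⊥ (subst (_ ∈_) (trans (cong f (∣∣≡0⇒≡⊥ T e)) f⊥≡⊥) t∈fT))
      ∈f-sized (suc k) T e t∈fT with ∣∣>0⇒∃∈ T (subst (0 <_) (sym e) (s≤s z≤n))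
      ... | x , x∈T = ∈f-step k T x x∈T e (∈f-sized k (del x T) (suc-injective (trans (∣del∣ x T x∈T) e))) t∈fT

    ∈f⇒InImage : ∀ {T t} → t ∈ f T → InImage T t
    ∈f⇒InImage {T} = ∈f-sized ∣ T ∣ T refl

    π-surjective : ∀ t → ∃ λ s → π s ≡ t
    π-surjective t with ∈f⇒InImage (subst (t ∈_) (sym (∣p∣≡n⇒p≡⊤ (trans (∣f∣≡∣∣ ⊤) (∣⊤∣≡n n)))) ∈⊤)
    ... | s , _ , πs≡t = s , πs≡t


module Characterisation where

  open import Data.Nat using (ℕ; zero; suc; _≟_)
  open import Data.Nat.Properties using (<-irrefl; n≢0⇒n>0)
  open import Data.Fin using (Fin; punchOut)
  import Data.Fin.Properties as Fin
  open import Data.Fin.Subset using (Subset; _∈_; _⊆_; ⊥; ⁅_⁆; _∩_; ∣_∣; Nonempty)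
  open import Data.Fin.Subset.Properties using (∉⊥; ⊆-antisym; x∈p∪q⁻; x∈p∪q⁺; x∈⁅x⁆; x∈⁅y⁆⇒x≡y; ∩-zeroˡ)
  open import Data.Vec using (lookup; tabulate)
  open import Data.Vec.Properties using ([]=⇒lookup; lookup⇒[]=; lookup∘tabulate)
  open import Data.List using (List; []; _∷_)
  open import Data.List.Relation.Unary.Any using (Any; here; there)
  import Data.List.Relation.Unary.Any as Any
  open import Data.List.Relation.Unary.All using (All; []; _∷_)
  import Data.List.Relation.Unary.All as All
  open import Data.Product using (∃; _×_; _,_; proj₁; proj₂)
  open import Data.Sum using (inj₁; inj₂)
  open import Data.Empty using (⊥-elim)
  open import Relation.Nullary using (¬_; yes; no)
  open import Relation.Binary.PropositionalEquality
  open import Function.Definitions using (Bijective; Injective; Surjective)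
  open import Defs using (Reaction; reactants; inhibitors; products; products-nonempty; resL; enabled?; AllL)
  open SubsetProperties

  rightInverse⇒injective : ∀ {n} (σ ρ : Fin n → Fin n) → (∀ s → σ (ρ s) ≡ s) → Injective _≡_ _≡_ σ
  rightInverse⇒injective {zero} σ ρ σρ {()}
  rightInverse⇒injective {suc m} σ ρ σρ {i} {j} σi≡σj with i Fin.≟ j
  ... | yes i≡j = i≡j
  ... | no i≢j = ⊥-elim (<-irrefl refl (Fin.injective⇒≤ {f = squeeze} squeeze-injective))
    where
    -- ρ is injective and misses one of i and j, so it squeezes Fin (suc m) into Fin m.
    missed : Fin (suc m)
    missed with ρ (σ i) Fin.≟ i
    ... | yes _ = j
    ... | no _ = i
    ρ-injective : ∀ {x y} → ρ x ≡ ρ y → x ≡ y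
    ρ-injective {x} {y} h = trans (sym (σρ x)) (trans (cong σ h) (σρ y))
    avoids : ∀ y → ¬ (missed ≡ ρ y)
    avoids y h with ρ (σ i) Fin.≟ i
    ... | yes a = i≢j (trans (sym a) (trans (cong ρ (trans σi≡σj (trans (cong σ h) (σρ y)))) (sym h)))
    ... | no a = a (trans (cong ρ (trans (cong σ h) (σρ y))) (sym h))
    squeeze : Fin (suc m) → Fin m
    squeeze y = punchOut (avoids y)
    squeeze-injective : Injective _≡_ _≡_ squeeze
    squeeze-injective h = ρ-injective (Fin.punchOut-injective (avoids _) (avoids _) h)

  All×Any⇒Any : ∀ {X : Set} {P Q : X → Set} {xs} → All P xs → Any Q xs → Any (λ x → P x × Q x) xs
  All×Any⇒Any (p ∷ ps) (here q) = here (p , q)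
  All×Any⇒Any (p ∷ ps) (there a) = there (All×Any⇒Any ps a)

  module _ {n : ℕ} where

    Yields : Subset n → Fin n → Reaction n → Set
    Yields T t a = (reactants a ⊆ T) × (t ∈ products a)

    ∈resL⁻ : ∀ xs → AllL (λ a → inhibitors a ≡ ⊥) xs → ∀ {T t} → t ∈ resL xs T → Any (Yields T t) xs
    ∈resL⁻ [] _ t∈ = ⊥-elim (∉⊥ t∈)
    ∈resL⁻ (a ∷ xs) (_ AllL.∷ inh) {T} t∈ with enabled? a T
    ... | yes (R⊆T , _) with x∈p∪q⁻ (products a) (resL xs T) t∈
    ...   | inj₁ t∈P = here (R⊆T , t∈P)
    ...   | inj₂ t∈res = there (∈resL⁻ xs inh t∈res)
    ∈resL⁻ (a ∷ xs) (_ AllL.∷ inh) t∈ | no _ = there (∈resL⁻ xs inh t∈)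

    ∈resL⁺ : ∀ xs → AllL (λ a → inhibitors a ≡ ⊥) xs → ∀ {T t} → Any (Yields T t) xs → t ∈ resL xs T
    ∈resL⁺ (a ∷ xs) (I≡⊥ AllL.∷ inh) {T} y with enabled? a T
    ∈resL⁺ (a ∷ xs) (I≡⊥ AllL.∷ inh) (here (_ , t∈P)) | yes _ = x∈p∪q⁺ (inj₁ t∈P)
    ∈resL⁺ (a ∷ xs) (I≡⊥ AllL.∷ inh) (there y) | yes _ = x∈p∪q⁺ (inj₂ (∈resL⁺ xs inh y))
    ∈resL⁺ (a ∷ xs) (I≡⊥ AllL.∷ inh) {T} (here (R⊆T , _)) | no disabled =
      ⊥-elim (disabled (R⊆T , trans (cong (_∩ T) I≡⊥) (∩-zeroˡ T)))
    ∈resL⁺ (a ∷ xs) (I≡⊥ AllL.∷ inh) (there y) | no _ = ∈resL⁺ xs inh y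

    SingletonReactants : Reaction n → Fin n → Set
    SingletonReactants a s = reactants a ≡ ⁅ s ⁆

    Produces : List (Reaction n) → Fin n → Fin n → Set
    Produces rs s t = Any (λ a → SingletonReactants a s × t ∈ products a) rs

    -- Under this criterion res T = σ⁻¹[T], where σ t is the unique s such that {s} produces t.
    Criterion : List (Reaction n) → Set
    Criterion rs = All (λ a → Nonempty (reactants a)) rs
                 × (∀ s → Any (λ a → SingletonReactants a s) rs)
                 × (∀ t → ∃ λ s → Produces rs s t × (∀ s′ → Produces rs s′ t → s′ ≡ s))
                 × (∀ s t → Produces rs s t → All (λ a → t ∈ products a → s ∈ reactants a) rs)

  module System {n : ℕ} (rs : List (Reaction n)) (inh : AllL (λ a → inhibitors a ≡ ⊥) rs) where

    res : Subset n → Subset n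
    res = resL rs

    ∈res⁻ : ∀ {T t} → t ∈ res T → Any (Yields T t) rs
    ∈res⁻ = ∈resL⁻ rs inh

    ∈res⁺ : ∀ {T t} → Any (Yields T t) rs → t ∈ res T
    ∈res⁺ = ∈resL⁺ rs inh

    res-mono : ∀ {T U} → T ⊆ U → res T ⊆ res U
    res-mono T⊆U t∈ = ∈res⁺ (Any.map (λ (R⊆T , t∈P) → (λ {x} x∈R → T⊆U (R⊆T x∈R)) , t∈P) (∈res⁻ t∈))

    singleton⊆ : ∀ {a : Reaction n} {s} → SingletonReactants a s → reactants a ⊆ ⁅ s ⁆
    singleton⊆ e = subst (_ ∈_) e

    ⊆singleton : ∀ {a : Reaction n} {s} → reactants a ⊆ ⁅ s ⁆ → Nonempty (reactants a) → SingletonReactants a s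
    ⊆singleton {a} {s} R⊆ (x , x∈R) =
      ⊆-antisym R⊆ (λ y∈⁅s⁆ → subst (_∈ reactants a) (trans (x∈⁅y⁆⇒x≡y s (R⊆ x∈R)) (sym (x∈⁅y⁆⇒x≡y s y∈⁅s⁆))) x∈R)

    Produces⇒Yields : ∀ {s t} → Produces rs s t → Any (Yields ⁅ s ⁆ t) rs
    Produces⇒Yields = Any.map (λ {a} (R≡ , t∈P) → (λ {x} → singleton⊆ {a} R≡ {x}) , t∈P)

    module Sufficiency (criterion : Criterion rs) where

      private
        rows = proj₁ (proj₂ criterion)
        columns = proj₁ (proj₂ (proj₂ criterion))
        needs = proj₂ (proj₂ (proj₂ criterion))

      σ : Fin n → Fin n
      σ t = proj₁ (columns t)

      σ∈⇒∈res : ∀ T t → σ t ∈ T → t ∈ res T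
      σ∈⇒∈res T t σt∈T = ∈res⁺ (Any.map (λ (R⊆ , t∈P) → (λ {x} x∈R → subst (_∈ T) (sym (x∈⁅y⁆⇒x≡y (σ t) (R⊆ x∈R))) σt∈T) , t∈P)
                                        (Produces⇒Yields (proj₁ (proj₂ (columns t)))))

      ∈res⇒σ∈ : ∀ T t → t ∈ res T → σ t ∈ T
      ∈res⇒σ∈ T t t∈ with Any.satisfied (All×Any⇒Any (needs (σ t) t (proj₁ (proj₂ (columns t)))) (∈res⁻ t∈))
      ... | _ , needsσt , R⊆T , t∈P = R⊆T (needsσt t∈P)

      private
        someProduct : ∀ {s} {xs : List (Reaction n)} → Any (λ a → SingletonReactants a s) xs → ∃ λ t → Produces xs s t
        someProduct (here {x = a} R≡) = proj₁ (products-nonempty a) , here (R≡ , proj₂ (products-nonempty a))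
        someProduct (there x) = proj₁ (someProduct x) , there (proj₂ (someProduct x))

      ρ : Fin n → Fin n
      ρ s = proj₁ (someProduct (rows s))

      σρ : ∀ s → σ (ρ s) ≡ s
      σρ s = sym (proj₂ (proj₂ (columns (ρ s))) s (proj₂ (someProduct (rows s))))

      ρσ : ∀ t → ρ (σ t) ≡ t
      ρσ t = rightInverse⇒injective σ ρ σρ (σρ (σ t))

      res-injective : Injective _≡_ _≡_ res
      res-injective {T} {U} e = ⊆-antisym (transport T U e) (transport U T (sym e))
        where
        transport : ∀ V W → res V ≡ res W → V ⊆ W
        transport V W e {s} s∈V =
          subst (_∈ W) (σρ s) (∈res⇒σ∈ W (ρ s) (subst (ρ s ∈_) e (σ∈⇒∈res V (ρ s) (subst (_∈ V) (sym (σρ s)) s∈V))))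

      preimage : Subset n → Subset n
      preimage U = tabulate (λ s → lookup U (ρ s))

      ∈preimage⁻ : ∀ U s → s ∈ preimage U → ρ s ∈ U
      ∈preimage⁻ U s m = lookup⇒[]= (ρ s) U (trans (sym (lookup∘tabulate (λ s → lookup U (ρ s)) s)) ([]=⇒lookup m))

      ∈preimage⁺ : ∀ U s → ρ s ∈ U → s ∈ preimage U
      ∈preimage⁺ U s m = lookup⇒[]= s (preimage U) (trans (lookup∘tabulate (λ s → lookup U (ρ s)) s) ([]=⇒lookup m))

      res-surjective : Surjective _≡_ _≡_ res
      res-surjective U = preimage U , λ { refl →
        ⊆-antisym (λ {t} m → subst (_∈ U) (ρσ t) (∈preimage⁻ U (σ t) (∈res⇒σ∈ (preimage U) t m)))
                  (λ {t} m → σ∈⇒∈res (preimage U) t (∈preimage⁺ U (σ t) (subst (_∈ U) (sym (ρσ t)) m))) }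

      res-bijective : Bijective _≡_ _≡_ res
      res-bijective = res-injective , res-surjective

    module Necessity (bij : Bijective _≡_ _≡_ res) where

      open MonotoneSubsetMaps.Bijection res res-mono bij

      nonempty-reactants : All (λ a → Nonempty (reactants a)) rs
      nonempty-reactants = All.tabulate nonempty
        where
        nonempty : ∀ {a} → Any (a ≡_) rs → Nonempty (reactants a)
        nonempty {a} a∈rs with ∣ reactants a ∣ ≟ 0
        ... | no ∣R∣≢0 = ∣∣>0⇒∃∈ (reactants a) (n≢0⇒n>0 ∣R∣≢0)
        ... | yes ∣R∣≡0 = ⊥-elim (∉⊥ (subst (_ ∈_) f⊥≡⊥ (∈res⁺ (Any.map (λ { refl →
                (λ {x} x∈R → subst (x ∈_) (∣∣≡0⇒≡⊥ (reactants a) ∣R∣≡0) x∈R) , proj₂ (products-nonempty a) }) a∈rs))))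

      produces-π : ∀ s → Produces rs s (π s)
      produces-π s = Any.map (λ {a} (R≢∅ , R⊆ , t∈P) → ⊆singleton {a} R⊆ R≢∅ , t∈P)
                             (All×Any⇒Any nonempty-reactants (∈res⁻ (π∈f (x∈⁅x⁆ s))))

      produces⇒π : ∀ {s t} → Produces rs s t → t ≡ π s
      produces⇒π {s} {t} p = x∈⁅y⁆⇒x≡y (π s) (subst (t ∈_) (f⁅x⁆≡⁅πx⁆ s) (∈res⁺ (Produces⇒Yields p)))

      criterion : Criterion rs
      criterion = nonempty-reactants
                , (λ s → Any.map proj₁ (produces-π s))
                , column
                , (λ s t p → All.tabulate (λ a∈rs t∈P → needs s t p a∈rs t∈P))
        where
        column : ∀ t → ∃ λ s → Produces rs s t × (∀ s′ → Produces rs s′ t → s′ ≡ s)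
        column t with π-surjective t
        ... | s , πs≡t = s , subst (Produces rs s) πs≡t (produces-π s)
                       , λ s′ p′ → π-injective (trans (sym (produces⇒π p′)) (sym πs≡t))
        needs : ∀ s t → Produces rs s t → ∀ {a} → Any (a ≡_) rs → t ∈ products a → s ∈ reactants a
        needs s t p {a} a∈rs t∈P with ∈f⇒InImage (∈res⁺ (Any.map (λ { refl → (λ {x} x∈R → x∈R) , t∈P }) a∈rs))
        ... | s′ , s′∈R , πs′≡t = subst (_∈ reactants a) (π-injective (trans πs′≡t (produces⇒π p))) s′∈R


module MapAccumL where

  open import Data.Nat using (suc)
  open import Data.List using (List; []; _∷_; _++_; length)
  open import Data.Product using (_×_; _,_; proj₁; proj₂)
  open import Relation.Binary.PropositionalEquality

  mapAccumL : ∀ {S X Y : Set} → (S → X → S × Y) → S → List X → S × List Y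
  mapAccumL f s [] = s , []
  mapAccumL f s (x ∷ xs) = let r = f s x ; r2 = mapAccumL f (proj₁ r) xs in proj₁ r2 , proj₂ r ∷ proj₂ r2

  mapAccumL-length : ∀ {S X Y : Set} (f : S → X → S × Y) s xs → length (proj₂ (mapAccumL f s xs)) ≡ length xs
  mapAccumL-length f s [] = refl
  mapAccumL-length f s (x ∷ xs) = cong suc (mapAccumL-length f (proj₁ (f s x)) xs)

  mapAccumL-∷ : ∀ {S X Y : Set} (f : S → X → S × Y) q x xs {r} → mapAccumL f (proj₁ (f q x)) xs ≡ r →
    mapAccumL f q (x ∷ xs) ≡ (proj₁ r , proj₂ (f q x) ∷ proj₂ r)
  mapAccumL-∷ f q x xs e = cong (λ r → proj₁ r , proj₂ (f q x) ∷ proj₂ r) e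

  mapAccumL-++ : ∀ {S X Y : Set} (f : S → X → S × Y) q xs ys {q′ xs′ q″ ys′} →
    mapAccumL f q xs ≡ (q′ , xs′) → mapAccumL f q′ ys ≡ (q″ , ys′) → mapAccumL f q (xs ++ ys) ≡ (q″ , xs′ ++ ys′)
  mapAccumL-++ f q [] ys refl e = e
  mapAccumL-++ f q (x ∷ xs) ys refl e = cong (λ r → proj₁ r , proj₂ (f q x) ∷ proj₂ r) (mapAccumL-++ f (proj₁ (f q x)) xs ys refl e)


module FinEncodings where

  open import Data.Nat using (ℕ; zero; suc; _+_; _*_)
  open import Data.Bool using (Bool; true; false)
  open import Data.Fin using (Fin; splitAt; join; combine; remQuot)
  import Data.Fin as F
  open import Data.Fin.Properties using (splitAt-join; remQuot-combine)
  open import Data.List using (List; []; _∷_; length; lookup)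
  open import Data.List.Membership.Propositional using (_∈_)
  open import Data.List.Relation.Unary.Any using (index; here; there)
  open import Data.List.Relation.Unary.Any.Properties using (lookup-index)
  open import Data.Vec using (Vec; []; _∷_)
  open import Data.Product using (_×_; _,_)
  open import Data.Sum using (_⊎_; inj₁; inj₂)
  open import Data.Unit using (⊤; tt)
  open import Relation.Binary.PropositionalEquality

  record FinEncoding (A : Set) : Set where
    field
      card : ℕ
      code : A → Fin card
      decode : Fin card → A
      decode-code : ∀ a → decode (code a) ≡ a
  open FinEncoding public

  enc-listing : ∀ {X : Set} (xs : List X) → (∀ x → x ∈ xs) → FinEncoding X
  enc-listing xs complete = record
    { card = length xs ; code = λ x → index (complete x) ; decode = lookup xs
    ; decode-code = λ x → sym (lookup-index (complete x)) }

  enc-Fin : ∀ k → FinEncoding (Fin k)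
  enc-Fin k = record { card = k ; code = λ x → x ; decode = λ x → x ; decode-code = λ _ → refl }

  enc-⊤ : FinEncoding ⊤
  enc-⊤ = record { card = 1 ; code = λ _ → F.zero ; decode = λ _ → tt ; decode-code = λ _ → refl }

  enc-× : ∀ {X Y} → FinEncoding X → FinEncoding Y → FinEncoding (X × Y)
  enc-× EX EY = record
    { card = card EX * card EY
    ; code = λ (x , y) → combine (code EX x) (code EY y)
    ; decode = λ i → decode₂ (remQuot (card EY) i)
    ; decode-code = λ (x , y) → trans (cong decode₂ (remQuot-combine {card EX} {card EY} (code EX x) (code EY y)))
                                      (cong₂ _,_ (decode-code EX x) (decode-code EY y)) }
    where
    decode₂ : Fin (card EX) × Fin (card EY) → _
    decode₂ (i , j) = decode EX i , decode EY j

  enc-⊎ : ∀ {X Y} → FinEncoding X → FinEncoding Y → FinEncoding (X ⊎ Y)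
  enc-⊎ EX EY = record
    { card = card EX + card EY
    ; code = code⊎
    ; decode = λ i → decode⊎ (splitAt (card EX) i)
    ; decode-code = decode-code⊎ }
    where
    code⊎ : _ → Fin (card EX + card EY)
    code⊎ (inj₁ x) = join (card EX) (card EY) (inj₁ (code EX x))
    code⊎ (inj₂ y) = join (card EX) (card EY) (inj₂ (code EY y))
    decode⊎ : Fin (card EX) ⊎ Fin (card EY) → _
    decode⊎ (inj₁ i) = inj₁ (decode EX i)
    decode⊎ (inj₂ j) = inj₂ (decode EY j)
    decode-code⊎ : ∀ a → decode⊎ (splitAt (card EX) (code⊎ a)) ≡ a
    decode-code⊎ (inj₁ x) = trans (cong decode⊎ (splitAt-join (card EX) (card EY) (inj₁ (code EX x)))) (cong inj₁ (decode-code EX x))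
    decode-code⊎ (inj₂ y) = trans (cong decode⊎ (splitAt-join (card EX) (card EY) (inj₂ (code EY y)))) (cong inj₂ (decode-code EY y))

  enc-retract : ∀ {X Y} → FinEncoding Y → (f : X → Y) (g : Y → X) → (∀ a → g (f a) ≡ a) → FinEncoding X
  enc-retract EY f g gf = record
    { card = card EY ; code = λ a → code EY (f a) ; decode = λ i → g (decode EY i)
    ; decode-code = λ a → trans (cong g (decode-code EY (f a))) (gf a) }

  enc-Bool : FinEncoding Bool
  enc-Bool = enc-listing (false ∷ true ∷ []) λ { false → here refl ; true → there (here refl) }

  enc-Vec : ∀ {X} → FinEncoding X → ∀ k → FinEncoding (Vec X k)
  enc-Vec EX zero = enc-retract enc-⊤ (λ _ → tt) (λ _ → []) (λ { [] → refl })
  enc-Vec EX (suc k) = enc-retract (enc-× EX (enc-Vec EX k)) (λ { (x ∷ xs) → x , xs }) (λ (x , xs) → x ∷ xs) (λ { (x ∷ xs) → refl })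


module Alphabet where

  open import Data.Bool using (Bool)
  open import Data.Fin using (Fin)
  open import Data.List using ([]; _∷_)
  open import Data.List.Relation.Unary.Any using (here; there)
  open import Data.Vec using ([]; _∷_)
  open import Data.Product using (_×_; _,_)
  open import Data.Sum using (_⊎_; inj₁; inj₂)
  open import Data.Unit using (⊤; tt)
  open import Relation.Binary.PropositionalEquality
  open FinEncodings

  data Letter : Set where
    bit0 bit1 sep : Letter

  data Count : Set where
    none one many : Count

  -- The tape holds the header 1ⁿ# followed by one block R_a I_a P_a # per reaction. headerS and
  -- headerT mark the header cells s and t; blockS and blockT mark the cells of each block at
  -- offsets s and 2n + t (so they point into R_a and P_a); the # of a block counts R_a up to two.
  record Track : Set where
    constructor track
    field
      letter : Letter
      isHeader headerS headerT blockS blockT : Bool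
      count : Count
  open Track public

  record Cell : Set where
    constructor cell
    field
      isFirst isLast : Bool
      contents : Track
  open Cell public

  data TapeSymbol : Set where
    □ : TapeSymbol
    raw : Fin 3 → TapeSymbol
    written : Cell → TapeSymbol

  record Registers : Set where
    constructor registers
    field
      atFirst carryHeaderS carryHeaderT carryBlockS carryBlockT afterSep landed bitS bitT match covers nonemptyR inHeader : Bool
  open Registers public

  data Phase : Set where
    shiftT₁ resetS₁ shiftT₂ resetS₂ countR checkR findRows resetRows scanColumn nextColumn done : Phase

  record Control : Set where
    constructor control
    field
      phase : Phase
      verdict seen : Bool
  open Control public

  data State : Set where
    reading : Registers → State
    markLast : Control → State
    sweeping  : Control → Registers → State
    rewinding  : Control → State

  enc-Letter : FinEncoding Letter
  enc-Letter = enc-listing (bit0 ∷ bit1 ∷ sep ∷ []) λ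
    { bit0 → here refl ; bit1 → there (here refl) ; sep → there (there (here refl)) }

  enc-Count : FinEncoding Count
  enc-Count = enc-listing (none ∷ one ∷ many ∷ []) λ
    { none → here refl ; one → there (here refl) ; many → there (there (here refl)) }

  enc-Phase : FinEncoding Phase
  enc-Phase = enc-listing
    (shiftT₁ ∷ resetS₁ ∷ shiftT₂ ∷ resetS₂ ∷ countR ∷ checkR ∷ findRows ∷ resetRows ∷ scanColumn ∷ nextColumn ∷ done ∷ []) λ
    { shiftT₁ → here refl
    ; resetS₁ → there (here refl)
    ; shiftT₂ → there (there (here refl))
    ; resetS₂ → there (there (there (here refl)))
    ; countR → there (there (there (there (here refl))))
    ; checkR → there (there (there (there (there (here refl)))))
    ; findRows → there (there (there (there (there (there (here refl))))))
    ; resetRows → there (there (there (there (there (there (there (here refl)))))))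
    ; scanColumn → there (there (there (there (there (there (there (there (here refl))))))))
    ; nextColumn → there (there (there (there (there (there (there (there (there (here refl)))))))))
    ; done → there (there (there (there (there (there (there (there (there (there (here refl)))))))))) }

  enc-Track : FinEncoding Track
  enc-Track = enc-retract (enc-× enc-Letter (enc-× (enc-Vec enc-Bool 5) enc-Count))
    (λ (track l h s t s′ t′ c) → l , (h ∷ s ∷ t ∷ s′ ∷ t′ ∷ []) , c)
    (λ { (l , (h ∷ s ∷ t ∷ s′ ∷ t′ ∷ []) , c) → track l h s t s′ t′ c })
    (λ _ → refl)

  enc-Cell : FinEncoding Cell
  enc-Cell = enc-retract (enc-× (enc-× enc-Bool enc-Bool) enc-Track)
    (λ (cell f l p) → (f , l) , p) (λ ((f , l) , p) → cell f l p) (λ _ → refl)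

  enc-TapeSymbol : FinEncoding TapeSymbol
  enc-TapeSymbol = enc-retract (enc-⊎ enc-⊤ (enc-⊎ (enc-Fin 3) enc-Cell)) to from from-to
    where
    to : TapeSymbol → ⊤ ⊎ (Fin 3 ⊎ Cell)
    to □ = inj₁ tt
    to (raw x) = inj₂ (inj₁ x)
    to (written c) = inj₂ (inj₂ c)
    from : ⊤ ⊎ (Fin 3 ⊎ Cell) → TapeSymbol
    from (inj₁ _) = □
    from (inj₂ (inj₁ x)) = raw x
    from (inj₂ (inj₂ c)) = written c
    from-to : ∀ a → from (to a) ≡ a
    from-to □ = refl
    from-to (raw x) = refl
    from-to (written c) = refl

  enc-Registers : FinEncoding Registers
  enc-Registers = enc-retract (enc-Vec enc-Bool 13)
    (λ (registers a b c d e f g h i j k l m) → a ∷ b ∷ c ∷ d ∷ e ∷ f ∷ g ∷ h ∷ i ∷ j ∷ k ∷ l ∷ m ∷ [])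
    (λ { (a ∷ b ∷ c ∷ d ∷ e ∷ f ∷ g ∷ h ∷ i ∷ j ∷ k ∷ l ∷ m ∷ []) → registers a b c d e f g h i j k l m })
    (λ _ → refl)

  enc-Control : FinEncoding Control
  enc-Control = enc-retract (enc-× enc-Phase (enc-× enc-Bool enc-Bool))
    (λ (control p v s) → p , v , s) (λ (p , v , s) → control p v s) (λ _ → refl)

  enc-State : FinEncoding State
  enc-State = enc-retract (enc-⊎ enc-Registers (enc-⊎ enc-Control (enc-⊎ (enc-× enc-Control enc-Registers) enc-Control))) to from from-to
    where
    to : State → Registers ⊎ (Control ⊎ ((Control × Registers) ⊎ Control))
    to (reading q) = inj₁ q
    to (markLast c) = inj₂ (inj₁ c)
    to (sweeping c q) = inj₂ (inj₂ (inj₁ (c , q)))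
    to (rewinding c) = inj₂ (inj₂ (inj₂ c))
    from : Registers ⊎ (Control ⊎ ((Control × Registers) ⊎ Control)) → State
    from (inj₁ q) = reading q
    from (inj₂ (inj₁ c)) = markLast c
    from (inj₂ (inj₂ (inj₁ (c , q)))) = sweeping c q
    from (inj₂ (inj₂ (inj₂ c))) = rewinding c
    from-to : ∀ a → from (to a) ≡ a
    from-to (reading q) = refl
    from-to (markLast c) = refl
    from-to (sweeping c q) = refl
    from-to (rewinding c) = refl


module Sweeping where

  open import Data.Nat using (suc; _+_)
  open import Data.Nat.Properties using (+-suc; +-assoc)
  open import Data.Bool using (Bool; true; false; if_then_else_)
  open import Data.Fin using (Fin)
  open import Data.List using (List; []; _∷_; _++_; map; length)
  open import Data.List.Properties using (map-∘)
  open import Data.Product using (Σ; _×_; _,_; proj₁; proj₂)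
  open import Data.Empty using (⊥)
  open import Data.Unit using (⊤)
  open import Data.Sum using (_⊎_; inj₁; inj₂)
  open import Data.Maybe using (just)
  open import Relation.Binary.PropositionalEquality
  open import Defs using (TM; Move; left; right; stay; module TM; Config; cfg; run; moveHead; initConfig)
  open FinEncodings
  open Alphabet
  open MapAccumL

  -- Abstract so that type checking never unfolds the numeric codes of states and symbols.
  abstract
    codeSym : TapeSymbol → Fin (card enc-TapeSymbol)
    codeSym = code enc-TapeSymbol
    decodeSym : Fin (card enc-TapeSymbol) → TapeSymbol
    decodeSym = decode enc-TapeSymbol
    decodeSym-codeSym : ∀ x → decodeSym (codeSym x) ≡ x
    decodeSym-codeSym = decode-code enc-TapeSymbol
    codeState : State → Fin (card enc-State)
    codeState = code enc-State
    decodeState : Fin (card enc-State) → State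
    decodeState = decode enc-State
    decodeState-codeState : ∀ x → decodeState (codeState x) ≡ x
    decodeState-codeState = decode-code enc-State

  clear : Registers
  clear = record
    { atFirst = true ; carryHeaderS = false ; carryHeaderT = false ; carryBlockS = false ; carryBlockT = false
    ; afterSep = false ; landed = false ; bitS = false ; bitT = false ; match = false ; covers = true
    ; nonemptyR = true ; inHeader = true }

  module Machine (phaseStep : Control → Registers → Track → Registers × Track) (nextControl : Control → Registers → Control)
           (readStep : Registers → Fin 3 → Registers × Track) (startControl : Registers → Control) where

    sweepCell : Control → Registers → Cell → (State × TapeSymbol × Move) ⊎ Bool
    sweepCell c q (cell f l p) with phaseStep c q p
    ... | q′ , p′ = if l then inj₁ (rewinding (nextControl c q′) , written (cell f l p′) , stay)
                         else inj₁ (sweeping c q′ , written (cell f l p′) , right)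

    -- The machine first converts the raw input into cells, then marks the last cell and rewinds.
    -- Afterwards it alternates a left-to-right sweep, which rewrites every cell with phaseStep and
    -- picks the next control at the last cell, with a rewind to the first cell.
    transition : State → TapeSymbol → (State × TapeSymbol × Move) ⊎ Bool
    transition (reading q) □ = inj₁ (markLast (startControl q) , □ , left)
    transition (reading q) (raw r) = inj₁ (reading (proj₁ (readStep q r)) , written (cell (atFirst q) false (proj₂ (readStep q r))) , right)
    transition (reading q) (written _) = inj₂ false
    transition (markLast c) (written (cell f _ p)) = inj₁ (rewinding c , written (cell f true p) , stay)
    transition (markLast c) _ = inj₂ false
    transition (rewinding c) (written (cell f l p)) = if f then inj₁ (sweeping c clear , written (cell f l p) , stay)
                                         else inj₁ (rewinding c , written (cell f l p) , left)
    transition (rewinding c) _ = inj₂ false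
    transition (sweeping (control done o k) q) _ = inj₂ o
    transition (sweeping c q) (written x) = sweepCell c q x
    transition (sweeping c q) _ = inj₂ false

    codeAction : (State × TapeSymbol × Move) ⊎ Bool → (Fin (card enc-State) × Fin (card enc-TapeSymbol) × Move) ⊎ Bool
    codeAction (inj₁ (s , g , m)) = inj₁ (codeState s , codeSym g , m)
    codeAction (inj₂ b) = inj₂ b

    machine : TM
    machine = record
      { nStates = card enc-State
      ; nSymbols = card enc-TapeSymbol
      ; start = codeState (reading clear)
      ; blank = codeSym □
      ; input = λ r → codeSym (raw r)
      ; δ = λ i j → codeAction (transition (decodeState i) (decodeSym j)) }


    config : State → List TapeSymbol → TapeSymbol → List TapeSymbol → Config machine
    config s l x r = cfg (codeState s) (map codeSym l) (codeSym x) (map codeSym r)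

    move : Move → List TapeSymbol → TapeSymbol → List TapeSymbol → List TapeSymbol × TapeSymbol × List TapeSymbol
    move stay  l c r        = l , c , r
    move left  []      c r  = [] , □ , c ∷ r
    move left  (x ∷ l) c r  = l , x , c ∷ r
    move right l c []       = c ∷ l , □ , []
    move right l c (x ∷ r)  = c ∷ l , x , r

    moveHead-code : ∀ m l c r → moveHead machine m (map codeSym l) (codeSym c) (map codeSym r)
            ≡ (map codeSym (proj₁ (move m l c r)) , codeSym (proj₁ (proj₂ (move m l c r))) , map codeSym (proj₂ (proj₂ (move m l c r))))
    moveHead-code stay l c r = refl
    moveHead-code left [] c r = refl
    moveHead-code left (x ∷ l) c r = refl
    moveHead-code right l c [] = refl
    moveHead-code right l c (x ∷ r) = refl

    run-transition : ∀ t s l x r → run machine (suc t) (config s l x r) ≡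
       (Data.Sum.[ (λ { (s′ , y , m) → run machine t (config s′ (proj₁ (move m l y r)) (proj₁ (proj₂ (move m l y r))) (proj₂ (proj₂ (move m l y r)))) }) , just ] (transition s x))
    run-transition t s l x r with transition s x in eq
    ... | inj₂ b rewrite decodeState-codeState s | decodeSym-codeSym x | eq = refl
    ... | inj₁ (s′ , y , m) rewrite decodeState-codeState s | decodeSym-codeSym x | eq | moveHead-code m l y r = refl

    run-continue : ∀ t s l x r {s′ y m} → transition s x ≡ inj₁ (s′ , y , m) →
      run machine (suc t) (config s l x r) ≡ run machine t (config s′ (proj₁ (move m l y r)) (proj₁ (proj₂ (move m l y r))) (proj₂ (proj₂ (move m l y r))))
    run-continue t s l x r eq = trans (run-transition t s l x r) (cong (Data.Sum.[ _ , just ]) eq)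

    run-halt : ∀ t s l x r {b} → transition s x ≡ inj₂ b → run machine (suc t) (config s l x r) ≡ just b
    run-halt t s l x r eq = trans (run-transition t s l x r) (cong (Data.Sum.[ _ , just ]) eq)

    isNil : List Track → Bool
    isNil [] = true
    isNil (_ ∷ _) = false

    cellsFrom : Bool → Track → List Track → List Cell
    tailCells : Bool → Track → List Track → List Cell
    cellsFrom f p ps = cell f (isNil ps) p ∷ tailCells f p ps
    tailCells f p [] = []
    tailCells f p (p2 ∷ ps) = cellsFrom false p2 ps

    pushAll : Bool → Track → List Track → List TapeSymbol → List TapeSymbol
    pushAll f p [] acc = acc
    pushAll f p (p2 ∷ ps) acc = pushAll false p2 ps (written (cell f false p) ∷ acc)

    lastCell : Bool → Track → List Track → Cell
    lastCell f p [] = cell f true p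
    lastCell f p (p2 ∷ ps) = lastCell false p2 ps

    onTape : State → List TapeSymbol → List Track → List TapeSymbol → Config machine
    onTape s L [] R = config s L □ R
    onTape s L (p ∷ ps) R = config s L (written (cell true (isNil ps) p)) (map written (tailCells true p ps) ++ R)

    sweepResult : Control → Registers → Bool → Track → List Track → List TapeSymbol → Registers × List TapeSymbol × Cell
    sweepResult h q f p [] acc = proj₁ (phaseStep h q p) , acc , cell f true (proj₂ (phaseStep h q p))
    sweepResult h q f p (p2 ∷ ps) acc = sweepResult h (proj₁ (phaseStep h q p)) false p2 ps (written (cell f false (proj₂ (phaseStep h q p))) ∷ acc)

    Running : Control → Set
    Running (control done _ _) = ⊥
    Running _ = ⊤

    transition-sweeping : ∀ c q x → Running c → transition (sweeping c q) (written x) ≡ sweepCell c q x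
    transition-sweeping (control shiftT₁ _ _) q x _ = refl
    transition-sweeping (control resetS₁ _ _) q x _ = refl
    transition-sweeping (control shiftT₂ _ _) q x _ = refl
    transition-sweeping (control resetS₂ _ _) q x _ = refl
    transition-sweeping (control countR _ _) q x _ = refl
    transition-sweeping (control checkR _ _) q x _ = refl
    transition-sweeping (control findRows _ _) q x _ = refl
    transition-sweeping (control resetRows _ _) q x _ = refl
    transition-sweeping (control scanColumn _ _) q x _ = refl
    transition-sweeping (control nextColumn _ _) q x _ = refl

    run-sweep : ∀ c → Running c → ∀ q f p ps acc R t →
      run machine (suc (length ps) + t) (config (sweeping c q) acc (written (cell f (isNil ps) p)) (map written (tailCells f p ps) ++ R))
      ≡ run machine t (config (rewinding (nextControl c (proj₁ (sweepResult c q f p ps acc))))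
                         (proj₁ (proj₂ (sweepResult c q f p ps acc))) (written (proj₂ (proj₂ (sweepResult c q f p ps acc)))) R)
    run-sweep c running q f p [] acc R t = run-continue t (sweeping c q) acc _ R (trans (transition-sweeping c q _ running) refl)
    run-sweep c running q f p (p2 ∷ ps) acc R t =
      trans (run-continue (suc (length ps) + t) (sweeping c q) acc _ _ (transition-sweeping c q _ running))
            (run-sweep c running (proj₁ (phaseStep c q p)) false p2 ps _ R t)

    run-rewind : ∀ c f p ps acc R t →
      run machine (length ps + t) (config (rewinding c) (pushAll f p ps acc) (written (lastCell f p ps)) R)
      ≡ run machine t (config (rewinding c) acc (written (cell f (isNil ps) p)) (map written (tailCells f p ps) ++ R))
    run-rewind c f p [] acc R t = refl
    run-rewind c f p (p2 ∷ ps) acc R t =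
      trans (cong (λ k → run machine k (config (rewinding c) (pushAll false p2 ps (written (cell f false p) ∷ acc)) (written (lastCell false p2 ps)) R)) (sym (+-suc (length ps) t)))
      (trans (run-rewind c false p2 ps (written (cell f false p) ∷ acc) R (suc t))
            (run-continue t (rewinding c) _ _ _ refl))

    sweepResult-mapAccumL : ∀ h q f p ps acc →
      let M = mapAccumL (phaseStep h) q (p ∷ ps) in
      Σ (List Track) λ ps′ → (proj₂ M ≡ proj₂ (phaseStep h q p) ∷ ps′)
         × (length ps′ ≡ length ps)
         × (sweepResult h q f p ps acc ≡ (proj₁ M , pushAll f (proj₂ (phaseStep h q p)) ps′ acc , lastCell f (proj₂ (phaseStep h q p)) ps′))
    sweepResult-mapAccumL h q f p [] acc = [] , refl , refl , refl
    sweepResult-mapAccumL h q f p (p2 ∷ ps) acc with sweepResult-mapAccumL h (proj₁ (phaseStep h q p)) false p2 ps (written (cell f false (proj₂ (phaseStep h q p))) ∷ acc)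
    ... | ps′ , e1 , e2 , e3 = proj₂ (phaseStep h (proj₁ (phaseStep h q p)) p2) ∷ ps′ , cong (proj₂ (phaseStep h q p) ∷_) e1 , cong suc e2 , e3

    run-fuel : ∀ {a b cf} → a ≡ b → run machine a cf ≡ run machine b cf
    run-fuel {cf = cf} e = cong (λ k → run machine k cf) e

    run-round : ∀ c → Running c → ∀ p ps L R t →
      run machine ((suc (length ps) + suc (length ps)) + t) (onTape (sweeping c clear) L (p ∷ ps) R)
      ≡ run machine t (onTape (sweeping (nextControl c (proj₁ (mapAccumL (phaseStep c) clear (p ∷ ps)))) clear) L (proj₂ (mapAccumL (phaseStep c) clear (p ∷ ps))) R)
    run-round c running p ps L R t with sweepResult-mapAccumL c clear true p ps L
    ... | ps′ , e1 , e2 , e3 =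
      trans (run-fuel (+-assoc (suc (length ps)) (suc (length ps)) t))
      (trans (run-sweep c running clear true p ps L R (suc (length ps) + t))
      (trans (cong (λ z → run machine (suc (length ps) + t) (config (rewinding (nextControl c (proj₁ z))) (proj₁ (proj₂ z)) (written (proj₂ (proj₂ z))) R)) e3)
      (trans (run-fuel (trans (sym (+-suc (length ps) t)) (cong (_+ suc t) (sym e2))))
      (trans (run-rewind (nextControl c (proj₁ (mapAccumL (phaseStep c) clear (p ∷ ps)))) true (proj₂ (phaseStep c clear p)) ps′ L R (suc t))
             (trans (run-continue t _ _ _ _ refl)
             (cong (λ xs → run machine t (onTape (sweeping (nextControl c (proj₁ (mapAccumL (phaseStep c) clear (p ∷ ps)))) clear) L xs R)) (sym e1)))))))

    run-done : ∀ o k q L xs R t → run machine (suc t) (onTape (sweeping (control done o k) q) L xs R) ≡ just o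
    run-done o k q L [] R t = run-halt t _ _ _ _ refl
    run-done o k q L (p ∷ ps) R t = run-halt t _ _ _ _ refl

    pushCells : Bool → List Track → List TapeSymbol → List TapeSymbol
    pushCells f [] acc = acc
    pushCells f (p ∷ ps) acc = pushCells false ps (written (cell f false p) ∷ acc)

    run-reading : ∀ q (f : Bool) (e : atFirst q ≡ f) r w acc t → (∀ q′ r′ → atFirst (proj₁ (readStep q′ r′)) ≡ false) →
      run machine (suc (length w) + t) (config (reading q) acc (raw r) (map raw w))
      ≡ run machine t (config (reading (proj₁ (mapAccumL readStep q (r ∷ w)))) (pushCells f (proj₂ (mapAccumL readStep q (r ∷ w))) acc) □ [])
    run-reading q f refl r [] acc t notFirst = run-continue t _ _ _ _ refl
    run-reading q f refl r (r2 ∷ w) acc t notFirst =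
      trans (run-continue _ _ _ _ _ refl)
            (run-reading (proj₁ (readStep q r)) false (notFirst q r) r2 w _ t notFirst)

    pushCells-last : ∀ f p ps acc → pushCells f (p ∷ ps) acc ≡ written (cell (isFirst (lastCell f p ps)) false (contents (lastCell f p ps))) ∷ pushAll f p ps acc
    pushCells-last f p [] acc = refl
    pushCells-last f p (p2 ∷ ps) acc = pushCells-last false p2 ps (written (cell f false p) ∷ acc)

    lastCell-isLast : ∀ f p ps → cell (isFirst (lastCell f p ps)) true (contents (lastCell f p ps)) ≡ lastCell f p ps
    lastCell-isLast f p [] = refl
    lastCell-isLast f p (p2 ∷ ps) = lastCell-isLast false p2 ps


    run-initialise : ∀ r w t → (∀ q′ r′ → atFirst (proj₁ (readStep q′ r′)) ≡ false) →
      let M = mapAccumL readStep clear (r ∷ w) in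
      run machine (suc (length w) + suc (suc (length w + suc t))) (initConfig machine (r ∷ w))
      ≡ run machine t (onTape (sweeping (startControl (proj₁ M)) clear) [] (proj₂ M) (□ ∷ []))
    run-initialise r w t notFirst =
      trans (cong (λ z → run machine (suc (length w) + suc (suc (length w + suc t))) (cfg (codeState (reading clear)) [] (codeSym (raw r)) z)) (map-∘ {g = codeSym} {f = raw} w))
      (trans (run-reading clear true refl r w [] _ notFirst)
      (trans (run-continue _ _ _ _ _ refl)
      (trans (cong (λ z → run machine (suc (length w + suc t))
                           (config (markLast c) (proj₁ (move left z □ [])) (proj₁ (proj₂ (move left z □ []))) (proj₂ (proj₂ (move left z □ [])))))
                   (pushCells-last true p′ ps′ []))
      (trans (run-continue _ _ _ _ _ refl)
      (trans (cong (λ z → run machine (length w + suc t) (config (rewinding c) (pushAll true p′ ps′ []) (written z) (□ ∷ []))) (lastCell-isLast true p′ ps′))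
      (trans (run-fuel (cong (_+ suc t) (sym (mapAccumL-length readStep (proj₁ (readStep clear r)) w))))
      (trans (run-rewind c true p′ ps′ [] (□ ∷ []) (suc t))
             (run-continue _ _ _ _ _ refl))))))))
      where
      c = startControl (proj₁ (mapAccumL readStep clear (r ∷ w)))
      p′ = proj₂ (readStep clear r)
      ps′ = proj₂ (mapAccumL readStep (proj₁ (readStep clear r)) w)


module Program where

  open import Data.Nat using (ℕ; zero; suc; _≡ᵇ_)
  open import Data.Bool using (Bool; true; false; if_then_else_; _∧_; _∨_; not)
  open import Data.Fin using (Fin)
  import Data.Fin as F
  open import Data.List using (List; []; _∷_; _++_)
  open import Data.Product using (_×_; _,_)
  open Alphabet

  isSep : Letter → Bool
  isSep sep = true
  isSep _ = false

  isBit1 : Letter → Bool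
  isBit1 bit1 = true
  isBit1 _ = false

  isOne : Count → Bool
  isOne one = true
  isOne _ = false

  isNone : Count → Bool
  isNone none = true
  isNone _ = false

  bump : Count → Bool → Count
  bump c false = c
  bump none true = one
  bump one true = many
  bump many true = many

  toLetter : Fin 3 → Letter
  toLetter F.zero = bit0
  toLetter (F.suc F.zero) = bit1
  toLetter (F.suc (F.suc _)) = sep

  -- Unlike old ∨ cond and old ∧ cond, these compute as soon as the newly tested condition is known.
  orIf : Bool → Bool → Bool
  orIf old cond = if cond then true else old

  andIf : Bool → Bool → Bool
  andIf old cond = if cond then old else false

  unlessSep : Letter → Bool → Bool
  unlessSep y b = if isSep y then false else b

  readStep : Registers → Fin 3 → Registers × Track
  readStep q r =
    record q { atFirst = false ; afterSep = isSep y ; inHeader = inHeader q ∧ not (isSep y)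
             ; landed = orIf (landed q) (isSep y ∧ atFirst q) }
    , track y (inHeader q) (atFirst q) (atFirst q) (unlessSep y (afterSep q)) (unlessSep y (afterSep q)) none
    where y = toLetter r

  -- If the input starts with #, then n = 0 and res is trivially bijective.
  startControl : Registers → Control
  startControl q = control (if landed q then done else shiftT₁) true false

  -- Each sweep moves a mark one cell to the right by carrying it in a register; a mark carried
  -- onto the # that ends the header sets landed, which is how every loop below counts to n.
  shiftStep : Registers → Track → Registers × Track
  shiftStep q (track y h s t s′ t′ c) =
    record q { atFirst = false ; afterSep = isSep y ; carryHeaderS = unlessSep y s ; landed = orIf (landed q) (isSep y ∧ carryHeaderS q)
             ; carryBlockT = unlessSep y t′ }
    , track y h (carryHeaderS q) t s′ (unlessSep y (carryBlockT q)) c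

  resetStep : Registers → Track → Registers × Track
  resetStep q (track y h s t s′ t′ c) =
    record q { atFirst = false ; afterSep = isSep y } , track y h (atFirst q) t s′ t′ c

  countStep : Registers → Track → Registers × Track
  countStep q (track y h s t s′ t′ c) =
    record q { atFirst = false ; afterSep = isSep y ; carryHeaderS = unlessSep y s ; landed = orIf (landed q) (isSep y ∧ carryHeaderS q)
             ; carryBlockS = unlessSep y s′
             ; bitS = unlessSep y (if s′ then isBit1 y else bitS q) }
    , track y h (carryHeaderS q) t (unlessSep y (carryBlockS q)) t′ (if isSep y then (if h then c else bump c (bitS q)) else c)

  checkStep : Registers → Track → Registers × Track
  checkStep q (track y h s t s′ t′ c) =
    record q { atFirst = false ; afterSep = isSep y
             ; nonemptyR = andIf (nonemptyR q) (if isSep y then (if h then true else not (isNone c)) else true) }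
    , track y h (atFirst q) t (unlessSep y (afterSep q)) t′ c

  rowStep : Registers → Track → Registers × Track
  rowStep q (track y h s t s′ t′ c) =
    record q { atFirst = false ; afterSep = isSep y ; carryHeaderS = unlessSep y s ; landed = orIf (landed q) (isSep y ∧ carryHeaderS q)
             ; carryBlockS = unlessSep y s′
             ; bitS = unlessSep y (if s′ then isBit1 y else bitS q)
             ; match = if isSep y then (if h then match q else orIf (match q) (isOne c ∧ bitS q)) else match q }
    , track y h (carryHeaderS q) t (unlessSep y (carryBlockS q)) t′ c

  columnStep : Registers → Track → Registers × Track
  columnStep q (track y h s t s′ t′ c) =
    record q { atFirst = false ; afterSep = isSep y ; carryHeaderS = unlessSep y s ; landed = orIf (landed q) (isSep y ∧ carryHeaderS q)
             ; carryBlockS = unlessSep y s′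
             ; bitS = unlessSep y (if s′ then isBit1 y else bitS q)
             ; bitT = unlessSep y (if t′ then isBit1 y else bitT q)
             ; match = if isSep y then (if h then match q else orIf (match q) (isOne c ∧ bitS q ∧ bitT q)) else match q
             ; covers = if isSep y then (if h then covers q else andIf (covers q) (not (bitT q) ∨ bitS q)) else covers q }
    , track y h (carryHeaderS q) t (unlessSep y (carryBlockS q)) t′ c

  advanceStep : Registers → Track → Registers × Track
  advanceStep q (track y h s t s′ t′ c) =
    record q { atFirst = false ; afterSep = isSep y ; carryHeaderT = unlessSep y t ; landed = orIf (landed q) (isSep y ∧ carryHeaderT q)
             ; carryBlockT = unlessSep y t′ }
    , track y h (atFirst q) (carryHeaderT q) (unlessSep y (afterSep q)) (unlessSep y (carryBlockT q)) c

  phaseStep : Control → Registers → Track → Registers × Track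
  phaseStep (control shiftT₁ _ _) = shiftStep
  phaseStep (control shiftT₂ _ _) = shiftStep
  phaseStep (control resetS₁ _ _) = resetStep
  phaseStep (control resetS₂ _ _) = resetStep
  phaseStep (control countR _ _) = countStep
  phaseStep (control checkR _ _) = checkStep
  phaseStep (control findRows _ _) = rowStep
  phaseStep (control resetRows _ _) = checkStep
  phaseStep (control scanColumn _ _) = columnStep
  phaseStep (control nextColumn _ _) = advanceStep
  phaseStep (control done _ _) = λ q p → q , p

  -- In column t, seen records whether some s with {s} ↦ t was met: a second such s, or one
  -- whose column is not covered, refutes the verdict, and so does reaching the end unseen.
  nextControl : Control → Registers → Control
  nextControl (control shiftT₁ o k) q = control (if landed q then resetS₁ else shiftT₁) o k
  nextControl (control resetS₁ o k) q = control shiftT₂ o k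
  nextControl (control shiftT₂ o k) q = control (if landed q then resetS₂ else shiftT₂) o k
  nextControl (control resetS₂ o k) q = control countR o k
  nextControl (control countR o k) q = control (if landed q then checkR else countR) o k
  nextControl (control checkR o k) q = control findRows (o ∧ nonemptyR q) false
  nextControl (control findRows o k) q = control (if landed q then resetRows else findRows) (o ∧ match q) false
  nextControl (control resetRows o k) q = control scanColumn o false
  nextControl (control scanColumn o k) q =
    if landed q then control nextColumn ((o ∧ not (match q ∧ (not (covers q) ∨ k))) ∧ (k ∨ match q)) false
                else control scanColumn (o ∧ not (match q ∧ (not (covers q) ∨ k))) (k ∨ match q)
  nextControl (control nextColumn o k) q = control (if landed q then done else scanColumn) o false
  nextControl (control done o k) q = control done o k

  bitLetter : Bool → Letter
  bitLetter true = bit1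
  bitLetter false = bit0

  header : ℕ → ℕ → ℕ → ℕ → List Track
  header i zero hsP htP = track sep true (i ≡ᵇ hsP) (i ≡ᵇ htP) false false none ∷ []
  header i (suc k) hsP htP = track bit1 true (i ≡ᵇ hsP) (i ≡ᵇ htP) false false none ∷ header (suc i) k hsP htP

  block : ℕ → List Bool → ℕ → ℕ → Count → List Track
  block j [] msP mtP c = track sep false false false false false c ∷ []
  block j (b ∷ bs) msP mtP c = track (bitLetter b) false false false (j ≡ᵇ msP) (j ≡ᵇ mtP) none ∷ block (suc j) bs msP mtP c

  blocks : List (List Bool × Count) → ℕ → ℕ → List Track
  blocks [] msP mtP = []
  blocks ((bs , c) ∷ bcs) msP mtP = block 0 bs msP mtP c ++ blocks bcs msP mtP

  Tape : ℕ → ℕ → ℕ → List (List Bool × Count) → ℕ → ℕ → List Track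
  Tape n hsP htP bcs msP mtP = header 0 n hsP htP ++ blocks bcs msP mtP


module SweepEffects where

  open import Data.Nat using (ℕ; zero; suc; _+_; _≡ᵇ_)
  open import Data.Bool using (Bool; true; false; if_then_else_; _∧_; _∨_; not)
  open import Data.List using (List; []; _∷_; _++_)
  open import Data.Product using (_×_; _,_; proj₁; proj₂)
  open import Relation.Binary.PropositionalEquality
  open Alphabet
  open MapAccumL
  open Sweeping using (clear)
  open Program

  -- i + k, accumulated so that it unfolds in step with header i k.
  plusAcc : ℕ → ℕ → ℕ
  plusAcc i zero = i
  plusAcc i (suc k) = plusAcc (suc i) k

  mapCounts : (List Bool → Count → Count) → List (List Bool × Count) → List (List Bool × Count)
  mapCounts g [] = []
  mapCounts g ((bs , c) ∷ r) = (bs , g bs c) ∷ mapCounts g r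

  mapCounts-id : ∀ bcs → mapCounts (λ _ c → c) bcs ≡ bcs
  mapCounts-id [] = refl
  mapCounts-id ((bs , c) ∷ r) = cong ((bs , c) ∷_) (mapCounts-id r)

  foldBlocks : ∀ {V : Set} → (V → List Bool → Count → V) → V → List (List Bool × Count) → V
  foldBlocks h v [] = v
  foldBlocks h v ((bs , c) ∷ r) = foldBlocks h (h v bs c) r

  mapAccumL-blocks : ∀ {V : Set} (f : Registers → Track → Registers × Track) (qb : V → Registers) (g : List Bool → Count → Count) (h : V → List Bool → Count → V) msP mtP msP′ mtP′ →
    (∀ v bs c → mapAccumL f (qb v) (block 0 bs msP mtP c) ≡ (qb (h v bs c) , block 0 bs msP′ mtP′ (g bs c))) →
    ∀ v bcs → mapAccumL f (qb v) (blocks bcs msP mtP) ≡ (qb (foldBlocks h v bcs) , blocks (mapCounts g bcs) msP′ mtP′)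
  mapAccumL-blocks f qb g h msP mtP msP′ mtP′ H v [] = refl
  mapAccumL-blocks f qb g h msP mtP msP′ mtP′ H v ((bs , c) ∷ bcs) = mapAccumL-++ f (qb v) _ _ (H v bs c) (mapAccumL-blocks f qb g h msP mtP msP′ mtP′ H (h v bs c) bcs)

  foldBlocks-const : ∀ {V : Set} (v : V) bcs → foldBlocks (λ v _ _ → v) v bcs ≡ v
  foldBlocks-const v [] = refl
  foldBlocks-const v (_ ∷ r) = foldBlocks-const v r

  module ShiftSweep (hsP mtP : ℕ) (htP msP : ℕ) where
    headerRegs : ℕ → Registers
    headerRegs i = record clear { atFirst = i ≡ᵇ 0 ; carryHeaderS = i ≡ᵇ suc hsP }
    endRegs : ℕ → Registers
    endRegs j = record clear { atFirst = false ; afterSep = true ; landed = orIf false (j ≡ᵇ suc hsP) }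

    sweep-header : ∀ i k → mapAccumL shiftStep (headerRegs i) (header i k hsP htP) ≡ (endRegs (plusAcc i k) , header i k (suc hsP) htP)
    sweep-header i zero = refl
    sweep-header i (suc k) = mapAccumL-∷ shiftStep (headerRegs i) _ _ (sweep-header (suc i) k)

    blockRegs : Bool → ℕ → Registers
    blockRegs L j = record clear { atFirst = false ; afterSep = j ≡ᵇ 0 ; landed = L ; carryBlockT = j ≡ᵇ suc mtP }

    sweep-block : ∀ L j bs c → mapAccumL shiftStep (blockRegs L j) (block j bs msP mtP c) ≡ (blockRegs L 0 , block j bs msP (suc mtP) c)
    sweep-block L j [] c = refl
    sweep-block L j (true ∷ bs) c = mapAccumL-∷ shiftStep (blockRegs L j) _ _ (sweep-block L (suc j) bs c)
    sweep-block L j (false ∷ bs) c = mapAccumL-∷ shiftStep (blockRegs L j) _ _ (sweep-block L (suc j) bs c)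

    sweep-Tape : ∀ n bcs → mapAccumL shiftStep clear (Tape n hsP htP bcs msP mtP) ≡ (endRegs (plusAcc 0 n) , Tape n (suc hsP) htP bcs msP (suc mtP))
    sweep-Tape n bcs = trans (mapAccumL-++ shiftStep clear _ _ (sweep-header 0 n)
                   (mapAccumL-blocks shiftStep (λ L → blockRegs L 0) (λ _ c → c) (λ L _ _ → L) msP mtP msP (suc mtP) (λ L bs c → sweep-block L 0 bs c) _ bcs))
                   (cong₂ (λ L z → blockRegs L 0 , header 0 n (suc hsP) htP ++ blocks z msP (suc mtP)) (foldBlocks-const _ bcs) (mapCounts-id bcs))

  module ResetSweep (hsP htP : ℕ) (msP mtP : ℕ) where
    headerRegs : ℕ → Registers
    headerRegs i = record clear { atFirst = i ≡ᵇ 0 }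
    blockRegs : ℕ → Registers
    blockRegs j = record clear { atFirst = false ; afterSep = j ≡ᵇ 0 }

    sweep-header : ∀ i k → mapAccumL resetStep (headerRegs i) (header i k hsP htP) ≡ (blockRegs 0 , header i k 0 htP)
    sweep-header i zero = refl
    sweep-header i (suc k) = mapAccumL-∷ resetStep (headerRegs i) (track bit1 true (i ≡ᵇ hsP) (i ≡ᵇ htP) false false none) _ (sweep-header (suc i) k)

    sweep-block : ∀ j bs c → mapAccumL resetStep (blockRegs j) (block j bs msP mtP c) ≡ (blockRegs 0 , block j bs msP mtP c)
    sweep-block j [] c = refl
    sweep-block j (true ∷ bs) c = mapAccumL-∷ resetStep (blockRegs j) (track bit1 false false false (j ≡ᵇ msP) (j ≡ᵇ mtP) none) _ (sweep-block (suc j) bs c)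
    sweep-block j (false ∷ bs) c = mapAccumL-∷ resetStep (blockRegs j) (track bit0 false false false (j ≡ᵇ msP) (j ≡ᵇ mtP) none) _ (sweep-block (suc j) bs c)

    sweep-Tape : ∀ n bcs → mapAccumL resetStep clear (Tape n hsP htP bcs msP mtP) ≡ (blockRegs 0 , Tape n 0 htP bcs msP mtP)
    sweep-Tape n bcs = trans (mapAccumL-++ resetStep clear _ _ (sweep-header 0 n)
                   (mapAccumL-blocks resetStep (λ (_ : Bool) → blockRegs 0) (λ _ c → c) (λ L _ _ → L) msP mtP msP mtP (λ L bs c → sweep-block 0 bs c) false bcs))
                   (cong (λ z → blockRegs 0 , header 0 n 0 htP ++ blocks z msP mtP) (mapCounts-id bcs))

  bitAtMark : ℕ → List Bool → ℕ → Bool → Bool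
  bitAtMark j [] msP β = β
  bitAtMark j (b ∷ bs) msP β = bitAtMark (suc j) bs msP (if j ≡ᵇ msP then b else β)

  module CountSweep (hsP htP : ℕ) (msP mtP : ℕ) where
    headerRegs : ℕ → Registers
    headerRegs i = record clear { atFirst = i ≡ᵇ 0 ; carryHeaderS = i ≡ᵇ suc hsP }
    endRegs : Bool → Registers
    endRegs L = record clear { atFirst = false ; afterSep = true ; landed = L }

    sweep-header : ∀ i k → mapAccumL countStep (headerRegs i) (header i k hsP htP) ≡ (endRegs (orIf false (plusAcc i k ≡ᵇ suc hsP)) , header i k (suc hsP) htP)
    sweep-header i zero = refl
    sweep-header i (suc k) = mapAccumL-∷ countStep (headerRegs i) _ _ (sweep-header (suc i) k)

    blockRegs : Bool → ℕ → Bool → Registers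
    blockRegs L j β = record clear { atFirst = false ; afterSep = j ≡ᵇ 0 ; landed = L ; carryBlockS = j ≡ᵇ suc msP ; bitS = β }

    sweep-block : ∀ L j β bs c → mapAccumL countStep (blockRegs L j β) (block j bs msP mtP c) ≡ (endRegs L , block j bs (suc msP) mtP (bump c (bitAtMark j bs msP β)))
    sweep-block L j β [] c = refl
    sweep-block L j β (true ∷ bs) c = mapAccumL-∷ countStep (blockRegs L j β) _ _ (sweep-block L (suc j) _ bs c)
    sweep-block L j β (false ∷ bs) c = mapAccumL-∷ countStep (blockRegs L j β) _ _ (sweep-block L (suc j) _ bs c)

    sweep-Tape : ∀ n bcs → mapAccumL countStep clear (Tape n hsP htP bcs msP mtP)
             ≡ (endRegs (orIf false (plusAcc 0 n ≡ᵇ suc hsP)) , Tape n (suc hsP) htP (mapCounts (λ bs c → bump c (bitAtMark 0 bs msP false)) bcs) (suc msP) mtP)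
    sweep-Tape n bcs = trans (mapAccumL-++ countStep clear _ _ (sweep-header 0 n)
                   (mapAccumL-blocks countStep endRegs (λ bs c → bump c (bitAtMark 0 bs msP false)) (λ L _ _ → L) msP mtP (suc msP) mtP (λ L bs c → sweep-block L 0 false bs c) _ bcs))
                   (cong (λ L → endRegs L , header 0 n (suc hsP) htP ++ blocks (mapCounts (λ bs c → bump c (bitAtMark 0 bs msP false)) bcs) (suc msP) mtP) (foldBlocks-const _ bcs))

  module CheckSweep (hsP htP : ℕ) (msP mtP : ℕ) where
    headerRegs : ℕ → Registers
    headerRegs i = record clear { atFirst = i ≡ᵇ 0 }
    blockRegs : Bool → ℕ → Registers
    blockRegs o j = record clear { atFirst = false ; afterSep = j ≡ᵇ 0 ; nonemptyR = o }

    sweep-header : ∀ i k → mapAccumL checkStep (headerRegs i) (header i k hsP htP) ≡ (blockRegs true 0 , header i k 0 htP)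
    sweep-header i zero = refl
    sweep-header i (suc k) = mapAccumL-∷ checkStep (headerRegs i) (track bit1 true (i ≡ᵇ hsP) (i ≡ᵇ htP) false false none) _ (sweep-header (suc i) k)

    sweep-block : ∀ o j bs c → mapAccumL checkStep (blockRegs o j) (block j bs msP mtP c) ≡ (blockRegs (andIf o (not (isNone c))) 0 , block j bs 0 mtP c)
    sweep-block o j [] c = refl
    sweep-block o j (true ∷ bs) c = mapAccumL-∷ checkStep (blockRegs o j) (track bit1 false false false (j ≡ᵇ msP) (j ≡ᵇ mtP) none) _ (sweep-block o (suc j) bs c)
    sweep-block o j (false ∷ bs) c = mapAccumL-∷ checkStep (blockRegs o j) (track bit0 false false false (j ≡ᵇ msP) (j ≡ᵇ mtP) none) _ (sweep-block o (suc j) bs c)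

    sweep-Tape : ∀ n bcs → mapAccumL checkStep clear (Tape n hsP htP bcs msP mtP) ≡ (blockRegs (foldBlocks (λ o _ c → andIf o (not (isNone c))) true bcs) 0 , Tape n 0 htP bcs 0 mtP)
    sweep-Tape n bcs = trans (mapAccumL-++ checkStep clear _ _ (sweep-header 0 n)
                   (mapAccumL-blocks checkStep (λ o → blockRegs o 0) (λ _ c → c) (λ o _ c → andIf o (not (isNone c))) msP mtP 0 mtP (λ o bs c → sweep-block o 0 bs c) true bcs))
                   (cong (λ z → blockRegs (foldBlocks (λ o _ c → andIf o (not (isNone c))) true bcs) 0 , header 0 n 0 htP ++ blocks z 0 mtP) (mapCounts-id bcs))

  module RowSweep (hsP htP : ℕ) (msP mtP : ℕ) where
    headerRegs : ℕ → Registers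
    headerRegs i = record clear { atFirst = i ≡ᵇ 0 ; carryHeaderS = i ≡ᵇ suc hsP }

    endRegs : Bool → Bool → Registers
    endRegs L m = record clear { atFirst = false ; afterSep = true ; landed = L ; match = m }

    sweep-header : ∀ i k → mapAccumL rowStep (headerRegs i) (header i k hsP htP)
                    ≡ (endRegs (orIf false (plusAcc i k ≡ᵇ suc hsP)) false , header i k (suc hsP) htP)
    sweep-header i zero = refl
    sweep-header i (suc k) = mapAccumL-∷ rowStep (headerRegs i) (track bit1 true (i ≡ᵇ hsP) (i ≡ᵇ htP) false false none) _ (sweep-header (suc i) k)

    blockRegs : Bool → Bool → ℕ → Bool → Registers
    blockRegs L m j βR = record clear { atFirst = false ; afterSep = j ≡ᵇ 0 ; landed = L ; carryBlockS = j ≡ᵇ suc msP ; bitS = βR ; match = m }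

    sweep-block : ∀ L m j βR bs c → mapAccumL rowStep (blockRegs L m j βR) (block j bs msP mtP c)
       ≡ (endRegs L (orIf m (isOne c ∧ bitAtMark j bs msP βR)) , block j bs (suc msP) mtP c)
    sweep-block L m j βR [] c = refl
    sweep-block L m j βR (true ∷ bs) c = mapAccumL-∷ rowStep (blockRegs L m j βR) (track bit1 false false false (j ≡ᵇ msP) (j ≡ᵇ mtP) none) _ (sweep-block L m (suc j) _ bs c)
    sweep-block L m j βR (false ∷ bs) c = mapAccumL-∷ rowStep (blockRegs L m j βR) (track bit0 false false false (j ≡ᵇ msP) (j ≡ᵇ mtP) none) _ (sweep-block L m (suc j) _ bs c)

    blockUpdate : Bool → List Bool → Count → Bool
    blockUpdate m bs c = orIf m (isOne c ∧ bitAtMark 0 bs msP false)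

    sweep-Tape : ∀ n bcs → mapAccumL rowStep clear (Tape n hsP htP bcs msP mtP)
        ≡ (endRegs (orIf false (plusAcc 0 n ≡ᵇ suc hsP)) (foldBlocks blockUpdate false bcs) , Tape n (suc hsP) htP bcs (suc msP) mtP)
    sweep-Tape n bcs = trans (mapAccumL-++ rowStep clear _ _ (sweep-header 0 n)
                   (mapAccumL-blocks rowStep (λ v → endRegs (orIf false (plusAcc 0 n ≡ᵇ suc hsP)) v) (λ _ c → c) blockUpdate msP mtP (suc msP) mtP
                     (λ v bs c → sweep-block _ v 0 false bs c) false bcs))
                   (cong (λ z → endRegs (orIf false (plusAcc 0 n ≡ᵇ suc hsP)) (foldBlocks blockUpdate false bcs) , header 0 n (suc hsP) htP ++ blocks z (suc msP) mtP) (mapCounts-id bcs))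

  module ColumnSweep (hsP htP : ℕ) (msP mtP : ℕ) where
    headerRegs : ℕ → Registers
    headerRegs i = record clear { atFirst = i ≡ᵇ 0 ; carryHeaderS = i ≡ᵇ suc hsP }

    endRegs : Bool → Bool → Bool → Registers
    endRegs L m x = record clear { atFirst = false ; afterSep = true ; landed = L ; match = m ; covers = x }

    sweep-header : ∀ i k → mapAccumL columnStep (headerRegs i) (header i k hsP htP)
                    ≡ (endRegs (orIf false (plusAcc i k ≡ᵇ suc hsP)) false true , header i k (suc hsP) htP)
    sweep-header i zero = refl
    sweep-header i (suc k) = mapAccumL-∷ columnStep (headerRegs i) (track bit1 true (i ≡ᵇ hsP) (i ≡ᵇ htP) false false none) _ (sweep-header (suc i) k)

    blockRegs : Bool → Bool → Bool → ℕ → Bool → Bool → Registers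
    blockRegs L m x j βR βP = record clear { atFirst = false ; afterSep = j ≡ᵇ 0 ; landed = L ; carryBlockS = j ≡ᵇ suc msP ; bitS = βR ; bitT = βP ; match = m ; covers = x }

    sweep-block : ∀ L m x j βR βP bs c → mapAccumL columnStep (blockRegs L m x j βR βP) (block j bs msP mtP c)
       ≡ (endRegs L (orIf m (isOne c ∧ bitAtMark j bs msP βR ∧ bitAtMark j bs mtP βP)) (andIf x (not (bitAtMark j bs mtP βP) ∨ bitAtMark j bs msP βR))
         , block j bs (suc msP) mtP c)
    sweep-block L m x j βR βP [] c = refl
    sweep-block L m x j βR βP (true ∷ bs) c = mapAccumL-∷ columnStep (blockRegs L m x j βR βP) (track bit1 false false false (j ≡ᵇ msP) (j ≡ᵇ mtP) none) _ (sweep-block L m x (suc j) _ _ bs c)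
    sweep-block L m x j βR βP (false ∷ bs) c = mapAccumL-∷ columnStep (blockRegs L m x j βR βP) (track bit0 false false false (j ≡ᵇ msP) (j ≡ᵇ mtP) none) _ (sweep-block L m x (suc j) _ _ bs c)

    blockUpdate : Bool × Bool → List Bool → Count → Bool × Bool
    blockUpdate (m , x) bs c = orIf m (isOne c ∧ bitAtMark 0 bs msP false ∧ bitAtMark 0 bs mtP false) , andIf x (not (bitAtMark 0 bs mtP false) ∨ bitAtMark 0 bs msP false)

    sweep-Tape : ∀ n bcs → let V = foldBlocks blockUpdate (false , true) bcs in
      mapAccumL columnStep clear (Tape n hsP htP bcs msP mtP)
        ≡ (endRegs (orIf false (plusAcc 0 n ≡ᵇ suc hsP)) (proj₁ V) (proj₂ V) , Tape n (suc hsP) htP bcs (suc msP) mtP)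
    sweep-Tape n bcs = trans (mapAccumL-++ columnStep clear _ _ (sweep-header 0 n)
                   (mapAccumL-blocks columnStep (λ v → endRegs (orIf false (plusAcc 0 n ≡ᵇ suc hsP)) (proj₁ v) (proj₂ v)) (λ _ c → c) blockUpdate msP mtP (suc msP) mtP
                     (λ v bs c → sweep-block _ (proj₁ v) (proj₂ v) 0 false false bs c) (false , true) bcs))
                   (cong (λ z → endRegs (orIf false (plusAcc 0 n ≡ᵇ suc hsP)) (proj₁ (foldBlocks blockUpdate (false , true) bcs)) (proj₂ (foldBlocks blockUpdate (false , true) bcs))
                              , header 0 n (suc hsP) htP ++ blocks z (suc msP) mtP)
                         (mapCounts-id bcs))

  module AdvanceSweep (hsP htP : ℕ) (msP mtP : ℕ) where
    headerRegs : ℕ → Registers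
    headerRegs i = record clear { atFirst = i ≡ᵇ 0 ; carryHeaderT = i ≡ᵇ suc htP }
    endRegs : Bool → Registers
    endRegs L = record clear { atFirst = false ; afterSep = true ; landed = L }

    sweep-header : ∀ i k → mapAccumL advanceStep (headerRegs i) (header i k hsP htP) ≡ (endRegs (orIf false (plusAcc i k ≡ᵇ suc htP)) , header i k 0 (suc htP))
    sweep-header i zero = refl
    sweep-header i (suc k) = mapAccumL-∷ advanceStep (headerRegs i) (track bit1 true (i ≡ᵇ hsP) (i ≡ᵇ htP) false false none) _ (sweep-header (suc i) k)

    blockRegs : Bool → ℕ → Registers
    blockRegs L j = record clear { atFirst = false ; afterSep = j ≡ᵇ 0 ; landed = L ; carryBlockT = j ≡ᵇ suc mtP }

    sweep-block : ∀ L j bs c → mapAccumL advanceStep (blockRegs L j) (block j bs msP mtP c) ≡ (endRegs L , block j bs 0 (suc mtP) c)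
    sweep-block L j [] c = refl
    sweep-block L j (true ∷ bs) c = mapAccumL-∷ advanceStep (blockRegs L j) (track bit1 false false false (j ≡ᵇ msP) (j ≡ᵇ mtP) none) _ (sweep-block L (suc j) bs c)
    sweep-block L j (false ∷ bs) c = mapAccumL-∷ advanceStep (blockRegs L j) (track bit0 false false false (j ≡ᵇ msP) (j ≡ᵇ mtP) none) _ (sweep-block L (suc j) bs c)

    sweep-Tape : ∀ n bcs → mapAccumL advanceStep clear (Tape n hsP htP bcs msP mtP)
       ≡ (endRegs (orIf false (plusAcc 0 n ≡ᵇ suc htP)) , Tape n 0 (suc htP) bcs 0 (suc mtP))
    sweep-Tape n bcs = trans (mapAccumL-++ advanceStep clear _ _ (sweep-header 0 n)
                   (mapAccumL-blocks advanceStep (λ L → blockRegs L 0) (λ _ c → c) (λ L _ _ → L) msP mtP 0 (suc mtP) (λ L bs c → sweep-block L 0 bs c) _ bcs))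
                   (cong₂ (λ L z → endRegs L , header 0 n 0 (suc htP) ++ blocks z 0 (suc mtP)) (foldBlocks-const _ bcs) (mapCounts-id bcs))


module Reading where

  open import Data.Nat using (ℕ; zero; suc; _≡ᵇ_)
  open import Data.Bool using (Bool; true; false)
  open import Data.Fin using (Fin)
  open import Data.List using (List; []; _∷_; _++_; map; concatMap; replicate)
  open import Data.List.Properties using (map-++; ++-assoc)
  open import Data.Product using (_×_; _,_)
  open import Data.Vec using (toList)
  open import Relation.Binary.PropositionalEquality
  open import Defs using (RS; size; reactions; Reaction; reactants; inhibitors; products; encode; encReaction; encBit; sym1; symSep)
  open Alphabet
  open MapAccumL
  open Sweeping using (clear)
  open Program
  open SweepEffects

  headerRegs : ℕ → Registers
  headerRegs i = record clear { atFirst = i ≡ᵇ 0 }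
  endRegs : Bool → Registers
  endRegs L = record clear { atFirst = false ; afterSep = true ; inHeader = false ; landed = L }
  blockRegs : Bool → ℕ → Registers
  blockRegs L j = record clear { atFirst = false ; afterSep = j ≡ᵇ 0 ; inHeader = false ; landed = L }

  read-header : ∀ i k → mapAccumL readStep (headerRegs i) (replicate k sym1 ++ symSep ∷ []) ≡ (endRegs (orIf false (plusAcc i k ≡ᵇ 0)) , header i k 0 0)
  read-header i zero = refl
  read-header i (suc k) = mapAccumL-∷ readStep (headerRegs i) sym1 _ (read-header (suc i) k)

  read-block : ∀ L j bs → mapAccumL readStep (blockRegs L j) (map encBit bs ++ symSep ∷ []) ≡ (endRegs L , block j bs 0 0 none)
  read-block L j [] = refl
  read-block L j (true ∷ bs) = mapAccumL-∷ readStep (blockRegs L j) _ _ (read-block L (suc j) bs)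
  read-block L j (false ∷ bs) = mapAccumL-∷ readStep (blockRegs L j) _ _ (read-block L (suc j) bs)

  rawBlocks : List (List Bool) → List (Fin 3)
  rawBlocks [] = []
  rawBlocks (bs ∷ r) = (map encBit bs ++ symSep ∷ []) ++ rawBlocks r

  uncounted : List (List Bool) → List (List Bool × Count)
  uncounted = map (λ bs → bs , none)

  read-blocks : ∀ L bss → mapAccumL readStep (endRegs L) (rawBlocks bss) ≡ (endRegs L , blocks (uncounted bss) 0 0)
  read-blocks L [] = refl
  read-blocks L (bs ∷ bss) = mapAccumL-++ readStep (endRegs L) _ _ (read-block L 0 bs) (read-blocks L bss)

  reactionBits : ∀ {n} → Reaction n → List Bool
  reactionBits a = toList (reactants a) ++ toList (inhibitors a) ++ toList (products a)

  encReaction-bits : ∀ {n} (a : Reaction n) → encReaction a ≡ map encBit (reactionBits a) ++ symSep ∷ []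
  encReaction-bits a = sym (trans (cong (_++ symSep ∷ []) (trans (map-++ encBit (toList (reactants a)) _)
                                                (cong (map encBit (toList (reactants a)) ++_) (map-++ encBit (toList (inhibitors a)) _))))
               (trans (++-assoc (map encBit (toList (reactants a))) _ _)
                      (cong (map encBit (toList (reactants a)) ++_) (++-assoc (map encBit (toList (inhibitors a))) _ _))))

  encReactions-bits : ∀ {n} (rs : List (Reaction n)) → concatMap encReaction rs ≡ rawBlocks (map reactionBits rs)
  encReactions-bits [] = refl
  encReactions-bits (a ∷ rs) = cong₂ _++_ (encReaction-bits a) (encReactions-bits rs)

  allBits : RS → List (List Bool)
  allBits 𝒜 = map reactionBits (reactions 𝒜)

  read-encode : ∀ 𝒜 → mapAccumL readStep clear (encode 𝒜)
     ≡ (endRegs (orIf false (plusAcc 0 (size 𝒜) ≡ᵇ 0)) , Tape (size 𝒜) 0 0 (uncounted (allBits 𝒜)) 0 0)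
  read-encode 𝒜 =
    trans (cong (mapAccumL readStep clear) (trans (cong (λ z → replicate (size 𝒜) sym1 ++ symSep ∷ z) (encReactions-bits (reactions 𝒜)))
                                            (sym (++-assoc (replicate (size 𝒜) sym1) (symSep ∷ []) _))))
          (mapAccumL-++ readStep clear _ _ (read-header 0 (size 𝒜)) (read-blocks _ (allBits 𝒜)))


module TimeBound where

  open import Data.Nat
  open import Data.Nat.Properties
  open import Data.Nat.Solver
  open import Relation.Binary.PropositionalEquality
  open +-*-Solver

  readCost : ℕ → ℕ
  readCost L = L + suc (suc L)

  scheduleCost : ℕ → ℕ → ℕ
  scheduleCost d W = suc d * W + (W + (suc d * W + (W + (suc d * W + (W + (suc d * W + (W + suc d * (suc d * W + W))))))))

  scheduleCost≡ : ∀ d W → scheduleCost d W ≡ (5 + d) * ((2 + d) * W)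
  scheduleCost≡ = solve 2 (λ d W → let d+1 = con 1 :+ d in
      d+1 :* W :+ (W :+ (d+1 :* W :+ (W :+ (d+1 :* W :+ (W :+ (d+1 :* W :+ (W :+ d+1 :* (d+1 :* W :+ W))))))))
    := (con 5 :+ d) :* ((con 2 :+ d) :* W)) refl

  n≤n³ : ∀ n → suc n ≤ suc n ^ 3
  n≤n³ n = ≤-trans (m≤m*n (suc n) (suc n * suc n)) (≤-reflexive (solve 1 (λ x → (con 1 :+ x) :* ((con 1 :+ x) :* (con 1 :+ x)) := (con 1 :+ x) :^ 3) refl n))

  readCost+1≤ : ∀ L → readCost L + 1 ≤ 3 * suc L
  readCost+1≤ L = ≤-trans (m≤m+n _ L) (≤-reflexive (solve 1 (λ L → (L :+ (con 2 :+ L)) :+ con 1 :+ L := con 3 :* (con 1 :+ L)) refl L))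

  readCost-bound : ∀ L → readCost L + 1 ≤ 16 * suc L ^ 3
  readCost-bound L = begin
    readCost L + 1  ≤⟨ readCost+1≤ L ⟩
    3 * suc L       ≤⟨ *-monoʳ-≤ 3 (n≤n³ L) ⟩
    3 * suc L ^ 3   ≤⟨ *-monoˡ-≤ (suc L ^ 3) (m≤m+n 3 13) ⟩
    16 * suc L ^ 3  ∎
    where open ≤-Reasoning

  cost-bound : ∀ L d → suc (suc d) ≤ L → readCost L + (scheduleCost d (L + L) + 1) ≤ 16 * suc L ^ 3
  cost-bound L d 2+d≤L = begin
    readCost L + (scheduleCost d (L + L) + 1)
      ≡⟨ cong (λ z → readCost L + (z + 1)) (scheduleCost≡ d (L + L)) ⟩
    readCost L + ((5 + d) * ((2 + d) * (L + L)) + 1)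
      ≡⟨ solve 3 (λ r x y → r :+ (x :* y :+ con 1) := (r :+ con 1) :+ x :* y) refl (readCost L) (5 + d) ((2 + d) * (L + L)) ⟩
    (readCost L + 1) + (5 + d) * ((2 + d) * (L + L))
      ≤⟨ +-mono-≤ (≤-trans (readCost+1≤ L) (*-monoʳ-≤ 3 (n≤n³ L))) (*-mono-≤ 5+d≤ (*-mono-≤ 2+d≤ L+L≤)) ⟩
    3 * suc L ^ 3 + (3 * suc L) * (suc L * (2 * suc L))
      ≡⟨ solve 1 (λ m → con 3 :* m :^ 3 :+ (con 3 :* m) :* (m :* (con 2 :* m)) := con 9 :* m :^ 3) refl (suc L) ⟩
    9 * suc L ^ 3
      ≤⟨ *-monoˡ-≤ (suc L ^ 3) (m≤m+n 9 7) ⟩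
    16 * suc L ^ 3 ∎
    where
    open ≤-Reasoning
    5+d≤ : 5 + d ≤ 3 * suc L
    5+d≤ = ≤-trans (+-monoʳ-≤ 3 2+d≤L) (≤-trans (+-monoʳ-≤ 3 (m≤n*m L 3)) (≤-reflexive (sym (*-suc 3 L))))
    2+d≤ : 2 + d ≤ suc L
    2+d≤ = m≤n⇒m≤1+n 2+d≤L
    L+L≤ : L + L ≤ 2 * suc L
    L+L≤ = ≤-trans (+-mono-≤ (n≤1+n L) (n≤1+n L)) (≤-reflexive (solve 1 (λ L → (con 1 :+ L) :+ (con 1 :+ L) := con 2 :* (con 1 :+ L)) refl L))


module Timing where

  open import Data.Nat using (ℕ; zero; suc; _+_; _*_; _<_; _≤_; s≤s; z≤n; _≡ᵇ_)
  open import Data.Nat.Properties using (+-assoc; +-suc; +-comm; m≤m+n; <-irrefl)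
  open import Data.Empty using (⊥-elim)
  open import Data.Bool using (Bool; true; false; if_then_else_; _∧_; _∨_; not)
  open import Data.List using (List; []; _∷_; map; length)
  open import Data.Product using (_×_; _,_; proj₁; proj₂)
  open import Data.Maybe using (just)
  open import Relation.Binary.PropositionalEquality
  open import Relation.Nullary using (¬_)
  open import Defs using (run; Config; initConfig)
  open Alphabet
  open MapAccumL
  open Sweeping using (clear)
  open Program
  open SweepEffects
  open TimeBound using (readCost; scheduleCost)
  open Sweeping.Machine phaseStep nextControl readStep startControl

  record Reach (K : ℕ) (a b : Config machine) : Set where
    constructor rch
    field go : ∀ t → run machine (K + t) a ≡ run machine t b
  open Reach public

  _∙_ : ∀ {K1 K2 a b c} → Reach K1 a b → Reach K2 b c → Reach (K1 + K2) a c
  _∙_ {K1} {K2} r1 r2 = rch λ t → trans (run-fuel (+-assoc K1 K2 t)) (trans (go r1 (K2 + t)) (go r2 t))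
  infixr 5 _∙_

  iterate : ∀ {W} (S : ℕ → Config machine) (E : Config machine) n →
    (∀ r → suc r < n → Reach W (S r) (S (suc r))) → (∀ r → suc r ≡ n → Reach W (S r) E) →
    ∀ d r → r + suc d ≡ n → Reach (suc d * W) (S r) E
  iterate {W} S E n step final zero r e = subst (λ K → Reach K (S r) E) (sym (+-comm W 0)) (final r (trans (sym (+-comm r 1)) e))
  iterate {W} S E n step final (suc d) r e =
    step r (subst (suc r <_) e (lt r d)) ∙ iterate S E n step final d (suc r) (trans (sym (+-suc r (suc d))) e)
    where
    lt : ∀ r d → suc r < r + suc (suc d)
    lt r d rewrite +-suc r (suc d) | +-suc r d = s≤s (s≤s (m≤m+n r d))

  Reach-≡ : ∀ {K a b b′} → Reach K a b → b ≡ b′ → Reach K a b′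
  Reach-≡ r refl = r

  Reach-cost : ∀ {K K′ a b} → K ≡ K′ → Reach K a b → Reach K′ a b
  Reach-cost refl r = r

  atRound : Control → List Track → Config machine
  atRound c tp = onTape (sweeping c clear) [] tp (□ ∷ [])

  data NonEmpty {A : Set} : List A → Set where
    nonEmpty∷ : ∀ x xs → NonEmpty (x ∷ xs)

  Halts : ℕ → Config machine → Bool → Set
  Halts K a v = ∀ t → run machine (K + t) a ≡ just v

  _⟫_ : ∀ {K K′ a b v} → Reach K a b → Halts K′ b v → Halts (K + K′) a v
  _⟫_ {K} {K′} r h t = trans (run-fuel (+-assoc K K′ t)) (trans (go r (K′ + t)) (h t))
  infixr 4 _⟫_

  Halts-cost : ∀ {K K′ a v} → K ≡ K′ → Halts K a v → Halts K′ a v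
  Halts-cost refl h = h

  reach-round : ∀ c → Running c → ∀ tp {qF tp′} → NonEmpty tp → mapAccumL (phaseStep c) clear tp ≡ (qF , tp′) →
    Reach (length tp + length tp) (atRound c tp) (atRound (nextControl c qF) tp′)
  reach-round c running .(p ∷ ps) (nonEmpty∷ p ps) e = rch λ t → trans (run-round c running p ps [] (□ ∷ []) t) (cong (λ M → run machine t (atRound (nextControl c (proj₁ M)) (proj₂ M))) e)

  length-header : ∀ i k hsP htP → length (header i k hsP htP) ≡ suc k
  length-header i zero hsP htP = refl
  length-header i (suc k) hsP htP = cong suc (length-header (suc i) k hsP htP)

  length-block : ∀ j bs msP mtP c → length (block j bs msP mtP c) ≡ suc (length bs)
  length-block j [] msP mtP c = refl
  length-block j (b ∷ bs) msP mtP c = cong suc (length-block (suc j) bs msP mtP c)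

  blocksLength : List (List Bool × Count) → ℕ
  blocksLength [] = 0
  blocksLength ((bs , c) ∷ r) = suc (length bs) + blocksLength r

  open import Data.List.Properties using (length-++)

  length-blocks : ∀ bcs msP mtP → length (blocks bcs msP mtP) ≡ blocksLength bcs
  length-blocks [] msP mtP = refl
  length-blocks ((bs , c) ∷ r) msP mtP = trans (length-++ (block 0 bs msP mtP c)) (cong₂ _+_ (length-block 0 bs msP mtP c) (length-blocks r msP mtP))

  length-Tape : ∀ n hsP htP bcs msP mtP → length (Tape n hsP htP bcs msP mtP) ≡ suc n + blocksLength bcs
  length-Tape n hsP htP bcs msP mtP = trans (length-++ (header 0 n hsP htP)) (cong₂ _+_ (length-header 0 n hsP htP) (length-blocks bcs msP mtP))

  Tape-nonEmpty : ∀ n hsP htP bcs msP mtP → NonEmpty (Tape n hsP htP bcs msP mtP)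
  Tape-nonEmpty zero hsP htP bcs msP mtP = nonEmpty∷ _ _
  Tape-nonEmpty (suc n) hsP htP bcs msP mtP = nonEmpty∷ _ _

  bitsLength : List (List Bool) → ℕ
  bitsLength [] = 0
  bitsLength (bs ∷ r) = suc (length bs) + bitsLength r

  blocksLength-map : ∀ (f : List Bool → Count) bits → blocksLength (map (λ bs → bs , f bs) bits) ≡ bitsLength bits
  blocksLength-map f [] = refl
  blocksLength-map f (bs ∷ r) = cong (suc (length bs) +_) (blocksLength-map f r)

  roundCost : ℕ → List (List Bool) → ℕ
  roundCost n bits = (suc n + bitsLength bits) + (suc n + bitsLength bits)

  reach-round-Tape : ∀ c → Running c → ∀ n hsP htP (f : List Bool → Count) bits msP mtP {qF tp′} →
    mapAccumL (phaseStep c) clear (Tape n hsP htP (map (λ bs → bs , f bs) bits) msP mtP) ≡ (qF , tp′) →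
    Reach (roundCost n bits) (atRound c (Tape n hsP htP (map (λ bs → bs , f bs) bits) msP mtP)) (atRound (nextControl c qF) tp′)
  reach-round-Tape c running n hsP htP f bits msP mtP e =
    Reach-cost (cong (λ z → z + z) (trans (length-Tape n hsP htP bcs msP mtP) (cong (suc n +_) (blocksLength-map f bits))))
           (reach-round c running _ (Tape-nonEmpty n hsP htP bcs msP mtP) e)
    where bcs = map (λ bs → bs , f bs) bits

  plusAcc≡+ : ∀ i k → plusAcc i k ≡ i + k
  plusAcc≡+ i zero = sym (+-comm i 0)
  plusAcc≡+ i (suc k) = trans (plusAcc≡+ (suc i) k) (sym (+-suc i k))

  ≡ᵇ-refl : ∀ a → (a ≡ᵇ a) ≡ true
  ≡ᵇ-refl zero = refl
  ≡ᵇ-refl (suc a) = ≡ᵇ-refl a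

  ≢⇒≡ᵇfalse : ∀ a b → ¬ (a ≡ b) → (a ≡ᵇ b) ≡ false
  ≢⇒≡ᵇfalse zero zero nq = ⊥-elim (nq refl)
  ≢⇒≡ᵇfalse zero (suc b) nq = refl
  ≢⇒≡ᵇfalse (suc a) zero nq = refl
  ≢⇒≡ᵇfalse (suc a) (suc b) nq = ≢⇒≡ᵇfalse a b (λ e → nq (cong suc e))

  landed-last : ∀ n r → suc r ≡ n → orIf false (plusAcc 0 n ≡ᵇ suc r) ≡ true
  landed-last n r e rewrite plusAcc≡+ 0 n | e | ≡ᵇ-refl n = refl

  landed-early : ∀ n r → suc r < n → orIf false (plusAcc 0 n ≡ᵇ suc r) ≡ false
  landed-early n r lt rewrite plusAcc≡+ 0 n | ≢⇒≡ᵇfalse n (suc r) (λ e → <-irrefl (sym e) lt) = refl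

  countUpTo : List Bool → ℕ → Count
  countUpTo bs zero = none
  countUpTo bs (suc s) = bump (countUpTo bs s) (bitAtMark 0 bs s false)

  countedBlocks : List (List Bool) → ℕ → List (List Bool × Count)
  countedBlocks bits s = map (λ bs → bs , countUpTo bs s) bits

  mapCounts-countUpTo : ∀ s bits → mapCounts (λ bs c → bump c (bitAtMark 0 bs s false)) (countedBlocks bits s) ≡ countedBlocks bits (suc s)
  mapCounts-countUpTo s [] = refl
  mapCounts-countUpTo s (bs ∷ r) = cong (_ ∷_) (mapCounts-countUpTo s r)

  module Schedule (d : ℕ) (bits : List (List Bool)) where
    n : ℕ
    n = suc d

    W : ℕ
    W = roundCost n bits

    counted : ℕ → List (List Bool × Count)
    counted = countedBlocks bits

    shift₁-at : ℕ → Config machine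
    shift₁-at r = atRound (control shiftT₁ true false) (Tape n r 0 (counted 0) 0 r)
    shift₁-end = atRound (control resetS₁ true false) (Tape n n 0 (counted 0) 0 n)

    run-shift₁ : Reach (suc d * W) (shift₁-at 0) shift₁-end
    run-shift₁ = iterate shift₁-at shift₁-end n next-round last-round d 0 refl
      where
      next-round : ∀ r → suc r < n → Reach W (shift₁-at r) (shift₁-at (suc r))
      next-round r lt = Reach-≡ (reach-round-Tape (control shiftT₁ true false) _ n r 0 (λ bs → countUpTo bs 0) bits 0 r (ShiftSweep.sweep-Tape r r 0 0 n (counted 0)))
                        (cong (λ L → atRound (control (if L then resetS₁ else shiftT₁) true false) (Tape n (suc r) 0 (counted 0) 0 (suc r))) (landed-early n r lt))
      last-round : ∀ r → suc r ≡ n → Reach W (shift₁-at r) shift₁-end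
      last-round r e = Reach-≡ (reach-round-Tape (control shiftT₁ true false) _ n r 0 (λ bs → countUpTo bs 0) bits 0 r (ShiftSweep.sweep-Tape r r 0 0 n (counted 0)))
                        (cong₂ (λ L z → atRound (control (if L then resetS₁ else shiftT₁) true false) (Tape n z 0 (counted 0) 0 z)) (landed-last n r e) e)

    run-reset₁ : Reach W shift₁-end (atRound (control shiftT₂ true false) (Tape n 0 0 (counted 0) 0 n))
    run-reset₁ = reach-round-Tape (control resetS₁ true false) _ n n 0 (λ bs → countUpTo bs 0) bits 0 n (ResetSweep.sweep-Tape n 0 0 n n (counted 0))

    shift₂-at : ℕ → Config machine
    shift₂-at r = atRound (control shiftT₂ true false) (Tape n r 0 (counted 0) 0 (r + n))
    shift₂-end = atRound (control resetS₂ true false) (Tape n n 0 (counted 0) 0 (n + n))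

    run-shift₂ : Reach (suc d * W) (shift₂-at 0) shift₂-end
    run-shift₂ = iterate shift₂-at shift₂-end n next-round last-round d 0 refl
      where
      next-round : ∀ r → suc r < n → Reach W (shift₂-at r) (shift₂-at (suc r))
      next-round r lt = Reach-≡ (reach-round-Tape (control shiftT₂ true false) _ n r 0 (λ bs → countUpTo bs 0) bits 0 (r + n) (ShiftSweep.sweep-Tape r (r + n) 0 0 n (counted 0)))
                        (cong (λ L → atRound (control (if L then resetS₂ else shiftT₂) true false) (Tape n (suc r) 0 (counted 0) 0 (suc r + n))) (landed-early n r lt))
      last-round : ∀ r → suc r ≡ n → Reach W (shift₂-at r) shift₂-end
      last-round r e = Reach-≡ (reach-round-Tape (control shiftT₂ true false) _ n r 0 (λ bs → countUpTo bs 0) bits 0 (r + n) (ShiftSweep.sweep-Tape r (r + n) 0 0 n (counted 0)))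
                        (cong₂ (λ L z → atRound (control (if L then resetS₂ else shiftT₂) true false) (Tape n z 0 (counted 0) 0 (z + n))) (landed-last n r e) e)

    run-reset₂ : Reach W shift₂-end (atRound (control countR true false) (Tape n 0 0 (counted 0) 0 (n + n)))
    run-reset₂ = reach-round-Tape (control resetS₂ true false) _ n n 0 (λ bs → countUpTo bs 0) bits 0 (n + n) (ResetSweep.sweep-Tape n 0 0 (n + n) n (counted 0))

    count-at : ℕ → Config machine
    count-at s = atRound (control countR true false) (Tape n s 0 (counted s) s (n + n))
    count-end = atRound (control checkR true false) (Tape n n 0 (counted n) n (n + n))

    run-count : Reach (suc d * W) (count-at 0) count-end
    run-count = iterate count-at count-end n next-round last-round d 0 refl
      where
      next-round : ∀ r → suc r < n → Reach W (count-at r) (count-at (suc r))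
      next-round r lt = Reach-≡ (reach-round-Tape (control countR true false) _ n r 0 (λ bs → countUpTo bs r) bits r (n + n) (CountSweep.sweep-Tape r 0 r (n + n) n (counted r)))
                        (cong₂ (λ L z → atRound (control (if L then checkR else countR) true false) (Tape n (suc r) 0 z (suc r) (n + n))) (landed-early n r lt) (mapCounts-countUpTo r bits))
      last-round : ∀ r → suc r ≡ n → Reach W (count-at r) count-end
      last-round r e = Reach-≡ (reach-round-Tape (control countR true false) _ n r 0 (λ bs → countUpTo bs r) bits r (n + n) (CountSweep.sweep-Tape r 0 r (n + n) n (counted r)))
                        (trans (cong₂ (λ L z → atRound (control (if L then checkR else countR) true false) (Tape n (suc r) 0 z (suc r) (n + n))) (landed-last n r e) (mapCounts-countUpTo r bits))
                               (cong (λ z → atRound (control checkR true false) (Tape n z 0 (counted z) z (n + n))) e))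

    nonemptyVerdict : Bool
    nonemptyVerdict = foldBlocks (λ o _ c → andIf o (not (isNone c))) true (counted n)

    run-check : Reach W count-end (atRound (control findRows nonemptyVerdict false) (Tape n 0 0 (counted n) 0 (n + n)))
    run-check = reach-round-Tape (control checkR true false) _ n n 0 (λ bs → countUpTo bs n) bits n (n + n) (CheckSweep.sweep-Tape n 0 n (n + n) n (counted n))

    rowFound : ℕ → Bool
    rowFound s = foldBlocks (RowSweep.blockUpdate s 0 s (n + n)) false (counted n)

    rowsVerdict : ℕ → Bool
    rowsVerdict zero = nonemptyVerdict
    rowsVerdict (suc s) = rowsVerdict s ∧ rowFound s

    rows-at : ℕ → Config machine
    rows-at s = atRound (control findRows (rowsVerdict s) false) (Tape n s 0 (counted n) s (n + n))
    rows-end = atRound (control resetRows (rowsVerdict n) false) (Tape n n 0 (counted n) n (n + n))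

    run-rows : Reach (suc d * W) (rows-at 0) rows-end
    run-rows = iterate rows-at rows-end n next-round last-round d 0 refl
      where
      next-round : ∀ r → suc r < n → Reach W (rows-at r) (rows-at (suc r))
      next-round r lt = Reach-≡ (reach-round-Tape (control findRows (rowsVerdict r) false) _ n r 0 (λ bs → countUpTo bs n) bits r (n + n) (RowSweep.sweep-Tape r 0 r (n + n) n (counted n)))
                        (cong (λ L → atRound (control (if L then resetRows else findRows) (rowsVerdict (suc r)) false) (Tape n (suc r) 0 (counted n) (suc r) (n + n))) (landed-early n r lt))
      last-round : ∀ r → suc r ≡ n → Reach W (rows-at r) rows-end
      last-round r e = Reach-≡ (reach-round-Tape (control findRows (rowsVerdict r) false) _ n r 0 (λ bs → countUpTo bs n) bits r (n + n) (RowSweep.sweep-Tape r 0 r (n + n) n (counted n)))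
                        (trans (cong (λ L → atRound (control (if L then resetRows else findRows) (rowsVerdict (suc r)) false) (Tape n (suc r) 0 (counted n) (suc r) (n + n))) (landed-last n r e))
                               (cong (λ z → atRound (control resetRows (rowsVerdict z) false) (Tape n z 0 (counted n) z (n + n))) e))

    run-resetRows : Reach W rows-end (atRound (control scanColumn (rowsVerdict n) false) (Tape n 0 0 (counted n) 0 (n + n)))
    run-resetRows = reach-round-Tape (control resetRows (rowsVerdict n) false) _ n n 0 (λ bs → countUpTo bs n) bits n (n + n) (CheckSweep.sweep-Tape n 0 n (n + n) n (counted n))

    matches : ℕ → ℕ → Bool
    matches t s = proj₁ (foldBlocks (ColumnSweep.blockUpdate s t s (t + (n + n))) (false , true) (counted n))
    columnCovers : ℕ → ℕ → Bool
    columnCovers t s = proj₂ (foldBlocks (ColumnSweep.blockUpdate s t s (t + (n + n))) (false , true) (counted n))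

    seenBefore : ℕ → ℕ → Bool
    seenBefore t zero = false
    seenBefore t (suc s) = seenBefore t s ∨ matches t s
    columnVerdict : ℕ → Bool → ℕ → Bool
    columnVerdict t o zero = o
    columnVerdict t o (suc s) = columnVerdict t o s ∧ not (matches t s ∧ (not (columnCovers t s) ∨ seenBefore t s))

    column-at : ℕ → Bool → ℕ → Config machine
    column-at t o s = atRound (control scanColumn (columnVerdict t o s) (seenBefore t s)) (Tape n s t (counted n) s (t + (n + n)))
    column-end : ℕ → Bool → Config machine
    column-end t o = atRound (control nextColumn (columnVerdict t o n ∧ seenBefore t n) false) (Tape n n t (counted n) n (t + (n + n)))

    run-column : ∀ t o → Reach (suc d * W) (column-at t o 0) (column-end t o)
    run-column t o = iterate (column-at t o) (column-end t o) n next-round last-round d 0 refl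
      where
      next-round : ∀ r → suc r < n → Reach W (column-at t o r) (column-at t o (suc r))
      next-round r lt =
        Reach-≡ (reach-round-Tape (control scanColumn (columnVerdict t o r) (seenBefore t r)) _ n r t (λ bs → countUpTo bs n) bits r (t + (n + n))
                                  (ColumnSweep.sweep-Tape r t r (t + (n + n)) n (counted n)))
                (cong (λ L → atRound (if L then control nextColumn (columnVerdict t o (suc r) ∧ seenBefore t (suc r)) false
                                           else control scanColumn (columnVerdict t o (suc r)) (seenBefore t (suc r)))
                                     (Tape n (suc r) t (counted n) (suc r) (t + (n + n))))
                      (landed-early n r lt))
      last-round : ∀ r → suc r ≡ n → Reach W (column-at t o r) (column-end t o)
      last-round r e =
        Reach-≡ (reach-round-Tape (control scanColumn (columnVerdict t o r) (seenBefore t r)) _ n r t (λ bs → countUpTo bs n) bits r (t + (n + n))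
                                  (ColumnSweep.sweep-Tape r t r (t + (n + n)) n (counted n)))
                (trans (cong (λ L → atRound (if L then control nextColumn (columnVerdict t o (suc r) ∧ seenBefore t (suc r)) false
                                                  else control scanColumn (columnVerdict t o (suc r)) (seenBefore t (suc r)))
                                            (Tape n (suc r) t (counted n) (suc r) (t + (n + n))))
                             (landed-last n r e))
                       (cong (λ z → atRound (control nextColumn (columnVerdict t o z ∧ seenBefore t z) false) (Tape n z t (counted n) z (t + (n + n)))) e))

    run-nextColumn : ∀ t o → Reach W (column-end t o)
       (atRound (control (if orIf false (plusAcc 0 n ≡ᵇ suc t) then done else scanColumn) (columnVerdict t o n ∧ seenBefore t n) false) (Tape n 0 (suc t) (counted n) 0 (suc t + (n + n))))
    run-nextColumn t o = reach-round-Tape (control nextColumn (columnVerdict t o n ∧ seenBefore t n) false) _ n n t (λ bs → countUpTo bs n) bits n (t + (n + n))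
                                          (AdvanceSweep.sweep-Tape n t n (t + (n + n)) n (counted n))

    verdictAfter : ℕ → Bool
    verdictAfter zero = rowsVerdict n
    verdictAfter (suc t) = columnVerdict t (verdictAfter t) n ∧ seenBefore t n

    columns-at : ℕ → Config machine
    columns-at t = column-at t (verdictAfter t) 0
    finished = atRound (control done (verdictAfter n) false) (Tape n 0 n (counted n) 0 (n + (n + n)))

    run-columns : Reach (suc d * (suc d * W + W)) (columns-at 0) finished
    run-columns = iterate columns-at finished n next-round last-round d 0 refl
      where
      next-round : ∀ t → suc t < n → Reach (suc d * W + W) (columns-at t) (columns-at (suc t))
      next-round t lt = run-column t (verdictAfter t) ∙ Reach-≡ (run-nextColumn t (verdictAfter t))
                   (cong (λ L → atRound (control (if L then done else scanColumn) (verdictAfter (suc t)) false) (Tape n 0 (suc t) (counted n) 0 (suc t + (n + n)))) (landed-early n t lt))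
      last-round : ∀ t → suc t ≡ n → Reach (suc d * W + W) (columns-at t) finished
      last-round t e = run-column t (verdictAfter t) ∙ Reach-≡ (run-nextColumn t (verdictAfter t))
                   (trans (cong (λ L → atRound (control (if L then done else scanColumn) (verdictAfter (suc t)) false) (Tape n 0 (suc t) (counted n) 0 (suc t + (n + n)))) (landed-last n t e))
                          (cong (λ z → atRound (control done (verdictAfter z) false) (Tape n 0 z (counted n) 0 (z + (n + n)))) e))

    run-schedule : Reach (scheduleCost d W) (shift₁-at 0) finished
    run-schedule = run-shift₁ ∙ run-reset₁ ∙ run-shift₂ ∙ run-reset₂ ∙ run-count ∙ run-check ∙ run-rows ∙ run-resetRows ∙ run-columns

    run-finished : Halts 1 finished (verdictAfter n)
    run-finished t = run-done (verdictAfter n) false clear [] (Tape n 0 n (counted n) 0 (n + (n + n))) (□ ∷ []) t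

  reach-read : ∀ xs {qF tp} → NonEmpty xs → mapAccumL readStep clear xs ≡ (qF , tp) →
    Reach (readCost (length xs)) (initConfig machine xs) (atRound (startControl qF) tp)
  reach-read .(r ∷ w) (nonEmpty∷ r w) e =
    rch λ t → trans (run-fuel (+-assoc (suc (length w)) _ t)) (trans (run-fuel (cong (λ z → suc (length w) + suc (suc z)) (sym (+-suc (length w) t))))
                    (trans (run-initialise r w t (λ _ _ → refl)) (cong (λ M → run machine t (atRound (startControl (proj₁ M)) (proj₂ M))) e)))

  answer : ℕ → List (List Bool) → Bool
  answer zero bits = true
  answer (suc d) bits = Schedule.verdictAfter d bits (suc d)



module RunningTime where

  open import Data.Nat using (ℕ; zero; suc; _+_; _^_; _*_; _≤_; _≡ᵇ_)
  open import Data.Nat.Properties using (m≤m+n; m+[n∸m]≡n)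
  open import Data.Bool using (true; false)
  open import Data.List using (List; []; _∷_; length)
  open import Data.Product using (Σ; _×_; _,_; proj₂)
  open import Data.Maybe using (just)
  open import Relation.Binary.PropositionalEquality
  open import Defs using (RS; size; reactions; Reaction; encode; run; initConfig)
  open Alphabet
  open MapAccumL
  open Sweeping using (clear)
  open Program
  open SweepEffects
  open Reading
  open Timing
  open TimeBound
  open Sweeping.Machine phaseStep nextControl readStep startControl

  mkRS : ∀ n → List (Reaction n) → RS
  mkRS n rs = record { size = n ; reactions = rs }

  length-encode : ∀ 𝒜 → length (encode 𝒜) ≡ suc (size 𝒜 + bitsLength (allBits 𝒜))
  length-encode 𝒜 = trans (sym (mapAccumL-length readStep clear (encode 𝒜)))
             (trans (cong (λ M → length (proj₂ M)) (read-encode 𝒜))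
             (trans (length-Tape (size 𝒜) 0 0 (uncounted (allBits 𝒜)) 0 0) (cong (suc (size 𝒜) +_) (blocksLength-map (λ _ → none) (allBits 𝒜)))))

  encode-nonEmpty : ∀ n rs → NonEmpty (encode (mkRS n rs))
  encode-nonEmpty zero rs = nonEmpty∷ _ _
  encode-nonEmpty (suc n) rs = nonEmpty∷ _ _

  reach-start : ∀ n rs → Reach (readCost (length (encode (mkRS n rs)))) (initConfig machine (encode (mkRS n rs)))
    (atRound (startControl (endRegs (orIf false (plusAcc 0 n ≡ᵇ 0)))) (Tape n 0 0 (uncounted (allBits (mkRS n rs))) 0 0))
  reach-start n rs = reach-read _ (encode-nonEmpty n rs) (read-encode (mkRS n rs))

  plusAcc-suc : ∀ d → (plusAcc 0 (suc d) ≡ᵇ 0) ≡ false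
  plusAcc-suc d rewrite plusAcc≡+ 0 (suc d) = refl

  halts-by-size : ∀ n rs → let 𝒜 = mkRS n rs in
    Σ ℕ λ K → K ≤ 16 * suc (length (encode 𝒜)) ^ 3 × Halts K (initConfig machine (encode 𝒜)) (answer n (allBits 𝒜))
  halts-by-size zero rs =
    readCost L + 1 ,
    readCost-bound L ,
    reach-start zero rs ⟫ run-done true false clear [] (Tape zero 0 0 (uncounted (allBits (mkRS zero rs))) 0 0) (□ ∷ [])
    where L = length (encode (mkRS zero rs))
  halts-by-size (suc d) rs =
    readCost L + (scheduleCost d (L + L) + 1) ,
    cost-bound L d (subst (suc (suc d) ≤_) (sym (length-encode 𝒜)) (m≤m+n (suc (suc d)) (bitsLength bits))) ,
    Halts-cost (sym (cong (λ ℓ → readCost L + (scheduleCost d (ℓ + ℓ) + 1)) (length-encode 𝒜)))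
      (Reach-≡ (reach-start (suc d) rs) (cong (λ b → atRound (startControl (endRegs (orIf false b))) (Tape (suc d) 0 0 (uncounted bits) 0 0)) (plusAcc-suc d))
       ⟫ Schedule.run-schedule d bits ⟫ Schedule.run-finished d bits)
    where
    𝒜 = mkRS (suc d) rs
    bits = allBits 𝒜
    L = length (encode 𝒜)

  run-encode : ∀ 𝒜 → run machine (16 * suc (length (encode 𝒜)) ^ 3) (initConfig machine (encode 𝒜)) ≡ just (answer (size 𝒜) (allBits 𝒜))
  run-encode 𝒜 with halts-by-size (size 𝒜) (reactions 𝒜)
  ... | K , K≤ , halts = trans (run-fuel (sym (m+[n∸m]≡n K≤))) (halts _)


module Counting where

  open import Data.Nat using (ℕ; zero; suc; _+_)
  open import Data.Bool using (Bool; true; false)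
  open import Data.Fin using (Fin; zero; suc; toℕ)
  open import Data.Fin.Subset using (Subset; ⊥; ⁅_⁆; inside; outside)
  open import Data.Vec using ([]; _∷_; lookup; toList)
  open import Data.List using (List; []; _∷_; _++_)
  open import Relation.Binary.PropositionalEquality
  open Alphabet
  open Program
  open SweepEffects using (bitAtMark)
  open Timing using (countUpTo)

  bitAt : List Bool → ℕ → Bool
  bitAt [] p = false
  bitAt (b ∷ bs) zero = b
  bitAt (b ∷ bs) (suc p) = bitAt bs p

  bitAtMark-suc : ∀ j bs q β → bitAtMark (suc j) bs (suc q) β ≡ bitAtMark j bs q β
  bitAtMark-suc j [] q β = refl
  bitAtMark-suc j (b ∷ bs) q β = bitAtMark-suc (suc j) bs q _

  bitAtMark-past : ∀ j bs β → bitAtMark (suc j) bs 0 β ≡ β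
  bitAtMark-past j [] β = refl
  bitAtMark-past j (b ∷ bs) β = bitAtMark-past (suc j) bs β

  bitAtMark≡bitAt : ∀ bs p → bitAtMark 0 bs p false ≡ bitAt bs p
  bitAtMark≡bitAt [] p = refl
  bitAtMark≡bitAt (b ∷ bs) zero = bitAtMark-past 0 bs b
  bitAtMark≡bitAt (b ∷ bs) (suc p) = trans (bitAtMark-suc 0 bs p false) (bitAtMark≡bitAt bs p)

  bump-comm : ∀ c x y → bump (bump c x) y ≡ bump (bump c y) x
  bump-comm c false y = refl
  bump-comm c true false = refl
  bump-comm none true true = refl
  bump-comm one true true = refl
  bump-comm many true true = refl

  countUpTo-∷ : ∀ b bs k → countUpTo (b ∷ bs) (suc k) ≡ bump (countUpTo bs k) b
  countUpTo-∷ b bs zero = cong (bump none) (bitAtMark-past 0 bs b)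
  countUpTo-∷ b bs (suc k) = trans (cong₂ bump (countUpTo-∷ b bs k) (bitAtMark≡bitAt (b ∷ bs) (suc k)))
                          (trans (bump-comm (countUpTo bs k) b (bitAt bs k)) (cong (λ z → bump (bump (countUpTo bs k) z) b) (sym (bitAtMark≡bitAt bs k))))

  countOnes : ∀ {n} → Subset n → Count
  countOnes [] = none
  countOnes (b ∷ R) = bump (countOnes R) b

  countUpTo-countOnes : ∀ {n} (R : Subset n) rest → countUpTo (toList R ++ rest) n ≡ countOnes R
  countUpTo-countOnes [] rest = refl
  countUpTo-countOnes (b ∷ R) rest = trans (countUpTo-∷ b (toList R ++ rest) _) (cong (λ z → bump z b) (countUpTo-countOnes R rest))

  bitAt-++-lookup : ∀ {n} (R : Subset n) rest (s : Fin n) → bitAt (toList R ++ rest) (toℕ s) ≡ lookup R s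
  bitAt-++-lookup (b ∷ R) rest zero = refl
  bitAt-++-lookup (b ∷ R) rest (suc s) = bitAt-++-lookup R rest s

  bitAt-++-skip : ∀ {n} (R : Subset n) rest q → bitAt (toList R ++ rest) (n + q) ≡ bitAt rest q
  bitAt-++-skip [] rest q = refl
  bitAt-++-skip (b ∷ R) rest q = bitAt-++-skip R rest q

  isNone⇒≡⊥ : ∀ {n} (R : Subset n) → isNone (countOnes R) ≡ true → R ≡ ⊥
  isNone⇒≡⊥ [] e = refl
  isNone⇒≡⊥ (false ∷ R) e = cong (false ∷_) (isNone⇒≡⊥ R e)
  isNone⇒≡⊥ (true ∷ R) e with countOnes R
  isNone⇒≡⊥ (true ∷ R) () | none
  isNone⇒≡⊥ (true ∷ R) () | one
  isNone⇒≡⊥ (true ∷ R) () | many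

  lookup⇒¬isNone : ∀ {n} (R : Subset n) s → lookup R s ≡ true → isNone (countOnes R) ≡ false
  lookup⇒¬isNone (true ∷ R) zero e with countOnes R
  ... | none = refl
  ... | one = refl
  ... | many = refl
  lookup⇒¬isNone (true ∷ R) (suc s) e with countOnes R
  ... | none = refl
  ... | one = refl
  ... | many = refl
  lookup⇒¬isNone (false ∷ R) (suc s) e = lookup⇒¬isNone R s e

  isOne⇒≡⁅⁆ : ∀ {n} (R : Subset n) s → isOne (countOnes R) ≡ true → lookup R s ≡ true → R ≡ ⁅ s ⁆
  isOne⇒≡⁅⁆ (true ∷ R) zero e1 e2 with countOnes R in eq
  ... | none = cong (inside ∷_) (isNone⇒≡⊥ R (cong isNone eq))
  isOne⇒≡⁅⁆ (true ∷ R) zero () e2 | one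
  isOne⇒≡⁅⁆ (true ∷ R) zero () e2 | many
  isOne⇒≡⁅⁆ (true ∷ R) (suc s) e1 e2 with countOnes R in eq
  ... | none with trans (sym (lookup⇒¬isNone R s e2)) (cong isNone eq)
  ...   | ()
  isOne⇒≡⁅⁆ (true ∷ R) (suc s) () e2 | one
  isOne⇒≡⁅⁆ (true ∷ R) (suc s) () e2 | many
  isOne⇒≡⁅⁆ (false ∷ R) (suc s) e1 e2 = cong (outside ∷_) (isOne⇒≡⁅⁆ R s e1 e2)

  countOnes-⊥ : ∀ {n} → countOnes (⊥ {n}) ≡ none
  countOnes-⊥ {zero} = refl
  countOnes-⊥ {suc n} = countOnes-⊥ {n}

  isOne-⁅⁆ : ∀ {n} (s : Fin n) → isOne (countOnes ⁅ s ⁆) ≡ true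
  isOne-⁅⁆ {suc n} zero rewrite countOnes-⊥ {n} = refl
  isOne-⁅⁆ (suc s) = isOne-⁅⁆ s

  lookup-⁅⁆ : ∀ {n} (s : Fin n) → lookup ⁅ s ⁆ s ≡ true
  lookup-⁅⁆ zero = refl
  lookup-⁅⁆ (suc s) = lookup-⁅⁆ s


module BooleanFolds where

  open import Data.Nat using (ℕ)
  open import Data.Bool using (Bool; true; false; _∧_)
  open import Data.List using (List; []; _∷_; map)
  open import Data.List.Relation.Unary.Any using (Any; here; there)
  open import Data.List.Relation.Unary.All using (All; []; _∷_)
  open import Data.Product using (_×_; _,_; proj₁; proj₂)
  open import Data.Sum using (_⊎_; inj₁; inj₂)
  open import Relation.Binary.PropositionalEquality
  open import Defs using (Reaction)
  open Alphabet using (Count)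
  open Program
  open SweepEffects
  open Reading using (reactionBits)

  ∧⁻ : ∀ {x y} → x ∧ y ≡ true → x ≡ true × y ≡ true
  ∧⁻ {true} {true} refl = refl , refl
  ∧⁺ : ∀ {x y} → x ≡ true → y ≡ true → x ∧ y ≡ true
  ∧⁺ refl refl = refl

  andIf⁻ : ∀ {o c} → andIf o c ≡ true → o ≡ true × c ≡ true
  andIf⁻ {true} {true} refl = refl , refl
  andIf⁺ : ∀ {o c} → o ≡ true → c ≡ true → andIf o c ≡ true
  andIf⁺ refl refl = refl
  orIf⁻ : ∀ {o c} → orIf o c ≡ true → o ≡ true ⊎ c ≡ true
  orIf⁻ {o} {true} e = inj₂ refl
  orIf⁻ {o} {false} e = inj₁ e
  orIfˡ : ∀ {o c} → o ≡ true → orIf o c ≡ true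
  orIfˡ {c = true} e = refl
  orIfˡ {c = false} e = e
  orIfʳ : ∀ {o c} → c ≡ true → orIf o c ≡ true
  orIfʳ refl = refl

  module Folds {n : ℕ} (g : List Bool → Count) where
    countedReactions : List (Reaction n) → List (List Bool × Count)
    countedReactions rs = map (λ bs → bs , g bs) (map reactionBits rs)

    foldAnd⁻ : ∀ (P : List Bool → Count → Bool) o rs → foldBlocks (λ o bs c → andIf o (P bs c)) o (countedReactions rs) ≡ true →
            o ≡ true × All (λ a → P (reactionBits a) (g (reactionBits a)) ≡ true) rs
    foldAnd⁻ P o [] e = e , []
    foldAnd⁻ P o (a ∷ rs) e with foldAnd⁻ P _ rs e
    ... | e1 , al = proj₁ (andIf⁻ e1) , proj₂ (andIf⁻ e1) ∷ al

    foldAnd⁺ : ∀ (P : List Bool → Count → Bool) o rs → o ≡ true → All (λ a → P (reactionBits a) (g (reactionBits a)) ≡ true) rs →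
            foldBlocks (λ o bs c → andIf o (P bs c)) o (countedReactions rs) ≡ true
    foldAnd⁺ P o [] e [] = e
    foldAnd⁺ P o (a ∷ rs) e (p ∷ al) = foldAnd⁺ P _ rs (andIf⁺ e p) al

    foldOr⁻ : ∀ (P : List Bool → Count → Bool) m rs → foldBlocks (λ m bs c → orIf m (P bs c)) m (countedReactions rs) ≡ true →
            m ≡ true ⊎ Any (λ a → P (reactionBits a) (g (reactionBits a)) ≡ true) rs
    foldOr⁻ P m [] e = inj₁ e
    foldOr⁻ P m (a ∷ rs) e with foldOr⁻ P _ rs e
    ... | inj₂ an = inj₂ (there an)
    ... | inj₁ e1 with orIf⁻ e1
    ...   | inj₁ e2 = inj₁ e2
    ...   | inj₂ e2 = inj₂ (here e2)

    foldOr⁺ˡ : ∀ (P : List Bool → Count → Bool) m rs → m ≡ true → foldBlocks (λ m bs c → orIf m (P bs c)) m (countedReactions rs) ≡ true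
    foldOr⁺ˡ P m [] e = e
    foldOr⁺ˡ P m (a ∷ rs) e = foldOr⁺ˡ P _ rs (orIfˡ e)

    foldOr⁺ : ∀ (P : List Bool → Count → Bool) m rs → Any (λ a → P (reactionBits a) (g (reactionBits a)) ≡ true) rs →
           foldBlocks (λ m bs c → orIf m (P bs c)) m (countedReactions rs) ≡ true
    foldOr⁺ P m (a ∷ rs) (here p) = foldOr⁺ˡ P _ rs (orIfʳ p)
    foldOr⁺ P m (a ∷ rs) (there an) = foldOr⁺ P _ rs an

    foldPair₁ : ∀ (P Q : List Bool → Count → Bool) v rs →
      proj₁ (foldBlocks (λ v bs c → orIf (proj₁ v) (P bs c) , andIf (proj₂ v) (Q bs c)) v (countedReactions rs))
        ≡ foldBlocks (λ m bs c → orIf m (P bs c)) (proj₁ v) (countedReactions rs)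
    foldPair₁ P Q v [] = refl
    foldPair₁ P Q v (a ∷ rs) = foldPair₁ P Q _ rs

    foldPair₂ : ∀ (P Q : List Bool → Count → Bool) v rs →
      proj₂ (foldBlocks (λ v bs c → orIf (proj₁ v) (P bs c) , andIf (proj₂ v) (Q bs c)) v (countedReactions rs))
        ≡ foldBlocks (λ o bs c → andIf o (Q bs c)) (proj₂ v) (countedReactions rs)
    foldPair₂ P Q v [] = refl
    foldPair₂ P Q v (a ∷ rs) = foldPair₂ P Q _ rs


module Decoding where

  open import Data.Nat using (ℕ; zero; suc; _+_; _<_; s≤s; _≟_)
  open import Data.Nat.Properties using (+-comm; +-assoc; <-irrefl; n<1+n; <-cmp; <-trans; m<n⇒m<1+n; m≤n⇒m<n∨m≡n; n≢0⇒n>0)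
  open import Data.Bool.Properties using (∨-zeroʳ)
  open import Data.Bool using (Bool; true; false; _∧_; _∨_; not)
  open import Data.Fin using (Fin; zero; suc; toℕ; fromℕ<)
  open import Data.Fin.Properties using (toℕ<n; toℕ-fromℕ<; toℕ-injective)
  open import Data.Fin.Subset using (Subset; _∈_; ⊥; Nonempty; ∣_∣)
  open import Data.Vec using (_∷_; lookup; toList)
  open import Data.Vec.Properties using ([]=⇒lookup; lookup⇒[]=)
  open import Data.List using (List; _∷_; _++_; map)
  open import Data.List.Relation.Unary.Any using (Any)
  import Data.List.Relation.Unary.Any as Any
  open import Data.List.Relation.Unary.All using (All; _∷_)
  import Data.List.Relation.Unary.All as All
  open import Data.Product using (Σ; ∃; _×_; _,_; proj₁; proj₂)
  open import Data.Sum using (inj₁; inj₂)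
  open import Data.Empty using (⊥-elim)
  open import Relation.Nullary using (yes; no)
  open import Relation.Binary using (tri<; tri≈; tri>)
  open import Relation.Binary.PropositionalEquality
  open import Defs using (Reaction; reactants; inhibitors; products; AllL)
  open Alphabet using (Count)
  open Program
  open SweepEffects
  open Reading using (reactionBits)
  open Timing using (countUpTo; module Schedule)
  open Counting
  open SubsetProperties using (∣∣≡0⇒≡⊥; ∣∣>0⇒∃∈)
  open BooleanFolds


  bitAt-lookup : ∀ {n} (P : Subset n) (t : Fin n) → bitAt (toList P) (toℕ t) ≡ lookup P t
  bitAt-lookup (b ∷ P) zero = refl
  bitAt-lookup (b ∷ P) (suc t) = bitAt-lookup P t

  productOffset : ∀ n t → t + (n + n) ≡ n + (n + t)
  productOffset n t = trans (+-comm t (n + n)) (+-assoc n n t)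

  <-suc-cases : ∀ {P : ℕ → Set} {k} → (∀ s → s < k → P s) → P k → ∀ s → s < suc k → P s
  <-suc-cases below at s (s≤s s≤k) with m≤n⇒m<n∨m≡n s≤k
  ... | inj₁ s<k = below s s<k
  ... | inj₂ refl = at

  module OfReactions {d : ℕ} (rs : List (Reaction (suc d))) (inh : AllL (λ a → inhibitors a ≡ ⊥) rs) where
    bits : List (List Bool)
    bits = map reactionBits rs

    open Schedule d bits
    open Characterisation
    open Characterisation.System rs inh
    open Folds {n} (λ bs → countUpTo bs n)

    bitAtMark-reactants : ∀ (a : Reaction n) (s : Fin n) → bitAtMark 0 (reactionBits a) (toℕ s) false ≡ lookup (reactants a) s
    bitAtMark-reactants a s = trans (bitAtMark≡bitAt (reactionBits a) (toℕ s)) (bitAt-++-lookup (reactants a) (toList (inhibitors a) ++ toList (products a)) s)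

    bitAtMark-products : ∀ (a : Reaction n) (t : Fin n) → bitAtMark 0 (reactionBits a) (toℕ t + (n + n)) false ≡ lookup (products a) t
    bitAtMark-products a t = trans (bitAtMark≡bitAt (reactionBits a) (toℕ t + (n + n)))
               (trans (cong (bitAt (reactionBits a)) (productOffset n (toℕ t)))
               (trans (bitAt-++-skip (reactants a) (toList (inhibitors a) ++ toList (products a)) (n + toℕ t))
               (trans (bitAt-++-skip (inhibitors a) (toList (products a)) (toℕ t)) (bitAt-lookup (products a) t))))

    countUpTo-reactants : ∀ (a : Reaction n) → countUpTo (reactionBits a) n ≡ countOnes (reactants a)
    countUpTo-reactants a = countUpTo-countOnes (reactants a) (toList (inhibitors a) ++ toList (products a))

    ∈⇒lookup : ∀ {x} {p : Subset n} → x ∈ p → lookup p x ≡ true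
    ∈⇒lookup = []=⇒lookup
    lookup⇒∈ : ∀ {x} {p : Subset n} → lookup p x ≡ true → x ∈ p
    lookup⇒∈ {x} {p} = lookup⇒[]= x p

    nonemptyTest⁻ : ∀ (a : Reaction n) → not (isNone (countUpTo (reactionBits a) n)) ≡ true → Nonempty (reactants a)
    nonemptyTest⁻ a e with ∣ reactants a ∣ ≟ 0
    ... | no nz = ∣∣>0⇒∃∈ (reactants a) (n≢0⇒n>0 nz)
    ... | yes z with trans (sym e) (cong (λ c → not (isNone c)) (trans (countUpTo-reactants a) (trans (cong countOnes (∣∣≡0⇒≡⊥ (reactants a) z)) (countOnes-⊥ {n}))))
    ...   | ()

    nonemptyTest⁺ : ∀ (a : Reaction n) → Nonempty (reactants a) → not (isNone (countUpTo (reactionBits a) n)) ≡ true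
    nonemptyTest⁺ a (x , mx) rewrite countUpTo-reactants a | lookup⇒¬isNone (reactants a) x (∈⇒lookup mx) = refl

    singletonTest⁻ : ∀ (a : Reaction n) (s : Fin n) → (isOne (countUpTo (reactionBits a) n) ∧ bitAtMark 0 (reactionBits a) (toℕ s) false) ≡ true → SingletonReactants a s
    singletonTest⁻ a s e = let e′ = trans (sym (cong₂ (λ c b → isOne c ∧ b) (countUpTo-reactants a) (bitAtMark-reactants a s))) e in
      isOne⇒≡⁅⁆ (reactants a) s (proj₁ (∧⁻ {isOne (countOnes (reactants a))} e′)) (proj₂ (∧⁻ {isOne (countOnes (reactants a))} e′))

    singletonTest⁺ : ∀ (a : Reaction n) (s : Fin n) → SingletonReactants a s → (isOne (countUpTo (reactionBits a) n) ∧ bitAtMark 0 (reactionBits a) (toℕ s) false) ≡ true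
    singletonTest⁺ a s sg = trans (cong₂ (λ c b → isOne c ∧ b) (countUpTo-reactants a) (bitAtMark-reactants a s))
                   (subst (λ R → (isOne (countOnes R) ∧ lookup R s) ≡ true) (sym sg) (∧⁺ (isOne-⁅⁆ s) (lookup-⁅⁆ s)))

    produceTest⁻ : ∀ (a : Reaction n) (s t : Fin n) → (isOne (countUpTo (reactionBits a) n) ∧ bitAtMark 0 (reactionBits a) (toℕ s) false ∧ bitAtMark 0 (reactionBits a) (toℕ t + (n + n)) false) ≡ true
          → SingletonReactants a s × t ∈ products a
    produceTest⁻ a s t e = let e1 = ∧⁻ {X} {Y ∧ Z} e ; e2 = ∧⁻ {Y} {Z} (proj₂ e1) in
      singletonTest⁻ a s (∧⁺ (proj₁ e1) (proj₁ e2)) , lookup⇒∈ (trans (sym (bitAtMark-products a t)) (proj₂ e2))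
      where
      X = isOne (countUpTo (reactionBits a) n)
      Y = bitAtMark 0 (reactionBits a) (toℕ s) false
      Z = bitAtMark 0 (reactionBits a) (toℕ t + (n + n)) false

    produceTest⁺ : ∀ (a : Reaction n) (s t : Fin n) → SingletonReactants a s × t ∈ products a →
          (isOne (countUpTo (reactionBits a) n) ∧ bitAtMark 0 (reactionBits a) (toℕ s) false ∧ bitAtMark 0 (reactionBits a) (toℕ t + (n + n)) false) ≡ true
    produceTest⁺ a s t (sg , mp) with ∧⁻ {isOne (countUpTo (reactionBits a) n)} {bitAtMark 0 (reactionBits a) (toℕ s) false} (singletonTest⁺ a s sg)
    ... | e1 , e2 = ∧⁺ e1 (∧⁺ e2 (trans (bitAtMark-products a t) (∈⇒lookup mp)))

    needsTest⁻ : ∀ (a : Reaction n) (s t : Fin n) → (not (bitAtMark 0 (reactionBits a) (toℕ t + (n + n)) false) ∨ bitAtMark 0 (reactionBits a) (toℕ s) false) ≡ true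
          → t ∈ products a → s ∈ reactants a
    needsTest⁻ a s t e mp = lookup⇒∈ (lem (trans (sym (cong₂ (λ x y → not x ∨ y) (bitAtMark-products a t) (bitAtMark-reactants a s))) e) (∈⇒lookup mp))
      where
      lem : ∀ {x y} → (not x ∨ y) ≡ true → x ≡ true → y ≡ true
      lem {true} e refl = e

    needsTest⁺ : ∀ (a : Reaction n) (s t : Fin n) → (t ∈ products a → s ∈ reactants a) →
          (not (bitAtMark 0 (reactionBits a) (toℕ t + (n + n)) false) ∨ bitAtMark 0 (reactionBits a) (toℕ s) false) ≡ true
    needsTest⁺ a s t h = trans (cong₂ (λ x y → not x ∨ y) (bitAtMark-products a t) (bitAtMark-reactants a s)) (lem (lookup (products a) t) refl)
      where
      lem : ∀ x → lookup (products a) t ≡ x → (not x ∨ lookup (reactants a) s) ≡ true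
      lem false e = refl
      lem true e = ∈⇒lookup (h (lookup⇒∈ e))

    nonemptyVerdict⁻ : nonemptyVerdict ≡ true → All (λ a → Nonempty (reactants a)) rs
    nonemptyVerdict⁻ e = All.map (λ {a} → nonemptyTest⁻ a) (proj₂ (foldAnd⁻ (λ _ c → not (isNone c)) true rs e))
    nonemptyVerdict⁺ : All (λ a → Nonempty (reactants a)) rs → nonemptyVerdict ≡ true
    nonemptyVerdict⁺ al = foldAnd⁺ (λ _ c → not (isNone c)) true rs refl (All.map (λ {a} → nonemptyTest⁺ a) al)

    rowFound⁻ : ∀ s → rowFound (toℕ s) ≡ true → Any (λ a → SingletonReactants a s) rs
    rowFound⁻ s e with foldOr⁻ (λ bs c → isOne c ∧ bitAtMark 0 bs (toℕ s) false) false rs e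
    ... | inj₁ ()
    ... | inj₂ an = Any.map (λ {a} → singletonTest⁻ a s) an
    rowFound⁺ : ∀ s → Any (λ a → SingletonReactants a s) rs → rowFound (toℕ s) ≡ true
    rowFound⁺ s an = foldOr⁺ (λ bs c → isOne c ∧ bitAtMark 0 bs (toℕ s) false) false rs (Any.map (λ {a} → singletonTest⁺ a s) an)

    produceTest : ℕ → ℕ → List Bool → Count → Bool
    produceTest t s bs c = isOne c ∧ bitAtMark 0 bs s false ∧ bitAtMark 0 bs (t + (n + n)) false
    needsTest : ℕ → ℕ → List Bool → Count → Bool
    needsTest t s bs c = not (bitAtMark 0 bs (t + (n + n)) false) ∨ bitAtMark 0 bs s false

    matches≡fold : ∀ t s → matches t s ≡ foldBlocks (λ m bs c → orIf m (produceTest t s bs c)) false (countedReactions rs)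
    matches≡fold t s = foldPair₁ (produceTest t s) (needsTest t s) (false , true) rs
    columnCovers≡fold : ∀ t s → columnCovers t s ≡ foldBlocks (λ o bs c → andIf o (needsTest t s bs c)) true (countedReactions rs)
    columnCovers≡fold t s = foldPair₂ (produceTest t s) (needsTest t s) (false , true) rs

    matches⁻ : ∀ t s → matches (toℕ t) (toℕ s) ≡ true → Produces rs s t
    matches⁻ t s e with foldOr⁻ (produceTest (toℕ t) (toℕ s)) false rs (trans (sym (matches≡fold (toℕ t) (toℕ s))) e)
    ... | inj₁ ()
    ... | inj₂ an = Any.map (λ {a} → produceTest⁻ a s t) an
    matches⁺ : ∀ t s → Produces rs s t → matches (toℕ t) (toℕ s) ≡ true
    matches⁺ t s p = trans (matches≡fold (toℕ t) (toℕ s)) (foldOr⁺ (produceTest (toℕ t) (toℕ s)) false rs (Any.map (λ {a} → produceTest⁺ a s t) p))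

    columnCovers⁻ : ∀ t s → columnCovers (toℕ t) (toℕ s) ≡ true → All (λ a → t ∈ products a → s ∈ reactants a) rs
    columnCovers⁻ t s e = All.map (λ {a} → needsTest⁻ a s t) (proj₂ (foldAnd⁻ (needsTest (toℕ t) (toℕ s)) true rs (trans (sym (columnCovers≡fold (toℕ t) (toℕ s))) e)))
    columnCovers⁺ : ∀ t s → All (λ a → t ∈ products a → s ∈ reactants a) rs → columnCovers (toℕ t) (toℕ s) ≡ true
    columnCovers⁺ t s al = trans (columnCovers≡fold (toℕ t) (toℕ s)) (foldAnd⁺ (needsTest (toℕ t) (toℕ s)) true rs refl (All.map (λ {a} → needsTest⁺ a s t) al))

    rowsVerdict⁻ : ∀ k → rowsVerdict k ≡ true → nonemptyVerdict ≡ true × (∀ s → s < k → rowFound s ≡ true)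
    rowsVerdict⁻ zero e = e , λ s ()
    rowsVerdict⁻ (suc k) e with ∧⁻ {rowsVerdict k} e
    ... | e₁ , e₂ = proj₁ (rowsVerdict⁻ k e₁) , <-suc-cases (proj₂ (rowsVerdict⁻ k e₁)) e₂

    rowsVerdict⁺ : ∀ k → nonemptyVerdict ≡ true → (∀ s → s < k → rowFound s ≡ true) → rowsVerdict k ≡ true
    rowsVerdict⁺ zero e h = e
    rowsVerdict⁺ (suc k) e h = ∧⁺ (rowsVerdict⁺ k e (λ s lt → h s (m<n⇒m<1+n lt))) (h k (n<1+n k))

    seenBefore⁻ : ∀ t k → seenBefore t k ≡ true → ∃ λ s → s < k × matches t s ≡ true
    seenBefore⁻ t zero ()
    seenBefore⁻ t (suc k) e with seenBefore t k in eq
    ... | true with seenBefore⁻ t k eq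
    ...   | s , lt , m = s , m<n⇒m<1+n lt , m
    seenBefore⁻ t (suc k) e | false = k , n<1+n k , e

    seenBefore⁺ : ∀ t k s → s < k → matches t s ≡ true → seenBefore t k ≡ true
    seenBefore⁺ t (suc k) s (s≤s s≤k) m with m≤n⇒m<n∨m≡n s≤k
    ... | inj₁ s<k rewrite seenBefore⁺ t k s s<k m = refl
    ... | inj₂ refl rewrite m = ∨-zeroʳ (seenBefore t k)

    unseen⁺ : ∀ t k → (∀ s → s < k → matches t s ≡ false) → seenBefore t k ≡ false
    unseen⁺ t zero h = refl
    unseen⁺ t (suc k) h rewrite unseen⁺ t k (λ s lt → h s (m<n⇒m<1+n lt)) = h k (n<1+n k)

    unseen⁻ : ∀ t k → seenBefore t k ≡ false → ∀ s → s < k → matches t s ≡ false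
    unseen⁻ t k e s lt with matches t s in eq
    ... | false = refl
    ... | true with trans (sym e) (seenBefore⁺ t k s lt eq)
    ...   | ()

    ColumnOk : ℕ → ℕ → Set
    ColumnOk t k = ∀ s → s < k → matches t s ≡ true → columnCovers t s ≡ true × (∀ s′ → s′ < s → matches t s′ ≡ false)

    verdictStep⁻ : ∀ {m x k} → not (m ∧ (not x ∨ k)) ≡ true → m ≡ true → x ≡ true × k ≡ false
    verdictStep⁻ {true} {true} {false} e refl = refl , refl

    verdictStep⁺ : ∀ {m x k} → (m ≡ true → x ≡ true × k ≡ false) → not (m ∧ (not x ∨ k)) ≡ true
    verdictStep⁺ {false} h = refl
    verdictStep⁺ {true} h with h refl
    ... | refl , refl = refl

    columnVerdict⁻ : ∀ t o k → columnVerdict t o k ≡ true → o ≡ true × ColumnOk t k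
    columnVerdict⁻ t o zero e = e , λ s ()
    columnVerdict⁻ t o (suc k) e with ∧⁻ {columnVerdict t o k} e
    ... | e₁ , e₂ = proj₁ (columnVerdict⁻ t o k e₁) , <-suc-cases (proj₂ (columnVerdict⁻ t o k e₁)) last
      where
      last : matches t k ≡ true → columnCovers t k ≡ true × (∀ s′ → s′ < k → matches t s′ ≡ false)
      last m with verdictStep⁻ {matches t k} {columnCovers t k} {seenBefore t k} e₂ m
      ... | covers , unseen = covers , unseen⁻ t k unseen

    columnVerdict⁺ : ∀ t o k → o ≡ true → ColumnOk t k → columnVerdict t o k ≡ true
    columnVerdict⁺ t o zero e h = e
    columnVerdict⁺ t o (suc k) e h = ∧⁺ (columnVerdict⁺ t o k e (λ s lt → h s (m<n⇒m<1+n lt)))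
                                         (verdictStep⁺ (λ m → let r = h k (n<1+n k) m in proj₁ r , unseen⁺ t k (proj₂ r)))

    verdictAfter⁻ : ∀ k → verdictAfter k ≡ true → rowsVerdict n ≡ true × (∀ t → t < k → ColumnOk t n × seenBefore t n ≡ true)
    verdictAfter⁻ zero e = e , λ t ()
    verdictAfter⁻ (suc k) e with ∧⁻ {columnVerdict k (verdictAfter k) n} e
    ... | e₁ , e₂ with columnVerdict⁻ k (verdictAfter k) n e₁
    ...   | e₃ , ok = proj₁ (verdictAfter⁻ k e₃) , <-suc-cases (proj₂ (verdictAfter⁻ k e₃)) (ok , e₂)

    verdictAfter⁺ : ∀ k → rowsVerdict n ≡ true → (∀ t → t < k → ColumnOk t n × seenBefore t n ≡ true) → verdictAfter k ≡ true
    verdictAfter⁺ zero e h = e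
    verdictAfter⁺ (suc k) e h =
      ∧⁺ (columnVerdict⁺ k (verdictAfter k) n (verdictAfter⁺ k e (λ t lt → h t (m<n⇒m<1+n lt))) (proj₁ (h k (n<1+n k)))) (proj₂ (h k (n<1+n k)))

    accepted⇒criterion : verdictAfter n ≡ true → Criterion rs
    accepted⇒criterion e with verdictAfter⁻ n e
    ... | rowsOk , h with rowsVerdict⁻ n rowsOk
    ...   | nonemptyOk , hr = nonemptyVerdict⁻ nonemptyOk
                     , (λ s → rowFound⁻ s (hr (toℕ s) (toℕ<n s)))
                     , column
                     , (λ s t p → columnCovers⁻ t s (proj₁ (proj₁ (h (toℕ t) (toℕ<n t)) (toℕ s) (toℕ<n s) (matches⁺ t s p))))
      where
      column : ∀ t → Σ (Fin n) λ s → Produces rs s t × (∀ s′ → Produces rs s′ t → s′ ≡ s)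
      column t with seenBefore⁻ (toℕ t) n (proj₂ (h (toℕ t) (toℕ<n t)))
      ... | s , lt , m = fromℕ< lt , matches⁻ t (fromℕ< lt) (subst (λ z → matches (toℕ t) z ≡ true) (sym (toℕ-fromℕ< lt)) m) , unique
        where
        P = proj₁ (h (toℕ t) (toℕ<n t))
        unique : ∀ s′ → Produces rs s′ t → s′ ≡ fromℕ< lt
        unique s′ ms′ with <-cmp (toℕ s′) s | matches⁺ t s′ ms′
        ... | tri< l _ _ | m′ with trans (sym m′) (proj₂ (P s lt m) (toℕ s′) l)
        ...   | ()
        unique s′ ms′ | tri≈ _ eq _ | m′ = toℕ-injective (trans eq (sym (toℕ-fromℕ< lt)))
        unique s′ ms′ | tri> _ _ g | m′ with trans (sym m) (proj₂ (P (toℕ s′) (toℕ<n s′) m′) s g)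
        ...   | ()

    criterion⇒accepted : Criterion rs → verdictAfter n ≡ true
    criterion⇒accepted (nonempty , rows , columns , needs) =
      verdictAfter⁺ n (rowsVerdict⁺ n (nonemptyVerdict⁺ nonempty) (λ s lt → subst (λ z → rowFound z ≡ true) (toℕ-fromℕ< lt) (rowFound⁺ (fromℕ< lt) (rows (fromℕ< lt)))))
        (λ t lt → columnOk t lt , seenAll t lt)
      where
      matches⁻′ : ∀ {t s} (lt : t < n) (ls : s < n) → matches t s ≡ true → Produces rs (fromℕ< ls) (fromℕ< lt)
      matches⁻′ {t} {s} lt ls m = matches⁻ (fromℕ< lt) (fromℕ< ls) (subst₂ (λ a b → matches a b ≡ true) (sym (toℕ-fromℕ< lt)) (sym (toℕ-fromℕ< ls)) m)
      columnOk : ∀ t → t < n → ColumnOk t n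
      columnOk t lt s ls m = subst₂ (λ a b → columnCovers a b ≡ true) (toℕ-fromℕ< lt) (toℕ-fromℕ< ls)
                                    (columnCovers⁺ (fromℕ< lt) (fromℕ< ls) (needs (fromℕ< ls) (fromℕ< lt) (matches⁻′ lt ls m)))
                      , λ s′ l′ → noEarlierMatch s′ l′
        where
        noEarlierMatch : ∀ s′ → s′ < s → matches t s′ ≡ false
        noEarlierMatch s′ l′ with matches t s′ in eq
        ... | false = refl
        ... | true = ⊥-elim (<-irrefl (cong toℕ (trans (proj₂ (proj₂ (columns (fromℕ< lt))) (fromℕ< ls′) (matches⁻′ lt ls′ eq))
                                                         (sym (proj₂ (proj₂ (columns (fromℕ< lt))) (fromℕ< ls) (matches⁻′ lt ls m)))))
                                      (subst₂ _<_ (sym (toℕ-fromℕ< ls′)) (sym (toℕ-fromℕ< ls)) l′))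
          where ls′ = <-trans l′ ls
      seenAll : ∀ t → t < n → seenBefore t n ≡ true
      seenAll t lt with columns (fromℕ< lt)
      ... | s , p , _ = seenBefore⁺ t n (toℕ s) (toℕ<n s) (subst (λ z → matches z (toℕ s) ≡ true) (toℕ-fromℕ< lt) (matches⁺ (fromℕ< lt) s p))


module Correctness where

  open import Data.Nat using (zero; suc)
  open import Data.Bool using (true)
  open import Data.List using (List; []; _∷_)
  open import Data.List.Relation.Unary.All using ([])
  open import Data.Product using (_×_; _,_)
  open import Data.Fin.Subset using (⊥)
  open import Relation.Binary.PropositionalEquality using (_≡_; refl)
  open import Function.Definitions using (Bijective)
  open import Defs using (size; reactions; Reaction; inhibitors; products-nonempty; resL; res; AllL; Inhibitorless)
  open Characterisation using (Criterion; module System)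
  open Reading using (allBits)
  open Timing using (answer)

  criterion-size0 : (rs : List (Reaction 0)) → Criterion rs
  criterion-size0 [] = [] , (λ ()) , (λ ()) , (λ ())
  criterion-size0 (a ∷ rs) with products-nonempty a
  ... | () , _

  answer-correct : ∀ n (rs : List (Reaction n)) (inh : AllL (λ a → inhibitors a ≡ ⊥) rs) →
    (answer n (allBits (RunningTime.mkRS n rs)) ≡ true → Bijective _≡_ _≡_ (resL rs))
    × (Bijective _≡_ _≡_ (resL rs) → answer n (allBits (RunningTime.mkRS n rs)) ≡ true)
  answer-correct zero rs inh = (λ _ → System.Sufficiency.res-bijective rs inh (criterion-size0 rs)) , (λ _ → refl)
  answer-correct (suc d) rs inh = (λ ok → System.Sufficiency.res-bijective rs inh (Decoding.OfReactions.accepted⇒criterion rs inh ok))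
                                , (λ bij → Decoding.OfReactions.criterion⇒accepted rs inh (System.Necessity.criterion rs inh bij))

  decides : ∀ 𝒜 → Inhibitorless 𝒜 →
    (answer (size 𝒜) (allBits 𝒜) ≡ true → Bijective _≡_ _≡_ (res 𝒜)) × (Bijective _≡_ _≡_ (res 𝒜) → answer (size 𝒜) (allBits 𝒜) ≡ true)
  decides 𝒜 = answer-correct (size 𝒜) (reactions 𝒜)


open import Defs
open import Data.Product using (∃; _,_)
open import Relation.Binary.PropositionalEquality using (_≡_)
open import Function.Definitions using (Bijective)
open Program using (phaseStep; nextControl; readStep; startControl)
open Sweeping.Machine phaseStep nextControl readStep startControl using (machine)

corollary18 : ∃ λ (M : TM) →
    DecidesInPolyTime M (λ 𝒜 → Bijective _≡_ _≡_ (res 𝒜))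
corollary18 = machine , 16 , 3 , λ 𝒜 inh →
  Timing.answer (size 𝒜) (Reading.allBits 𝒜) , RunningTime.run-encode 𝒜 , Correctness.decides 𝒜 inh
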